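{- Let $n\ge5$ and let $\tilde{\mathbf{D}}_n$ be the simply-laced tree on vertices $0,\dots,n$ with edges $1-2$, $0-2$, $2-3,\dots,(n-3)-(n-2)$, $(n-2)-(n-1)$, $(n-2)-n$. Then $\#\mathrm{Cl}(\tilde{\mathbf{D}}_n)=k+7$ if $n=2k$ and $k+4$ if $n=2k+1$. As minimal representatives one can take: $\ell_l$ (ones exactly at $0,1$), $\ell_r$ (ones exactly at $n-1,n$), $\ell_c$ (ones exactly at $0,1,n-1,n$); for $i=0,\dots,k-1$ the labeling with ones exactly at $2,4,\dots,2i$; and in addition, if $n=2k+1$, the labeling with ones exactly at $2,4,\dots,2k-2$ and at $n-1$, while if $n=2k$, the four labelings having exactly one of $d_0,d_1$ equal to $1$, exactly one of $d_{n-1},d_n$ equal to $1$, and on the vertices $2,\dots,n-2$ ones exactly at $3,5,\dots,n-3$.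
   Context: Reeder's puzzle on a finite connected simple graph: a labeling assigns $d_j\in\mathbb{Z}/2\mathbb{Z}$ to each vertex $j$; the move $T_i$ replaces $d_i$ by $d_i+\sum_k d_k \pmod 2$ (sum over neighbors $k$ of $i$), other labels unchanged. Equivalence is generated by moves; $\mathrm{Cl}(D)$ is the set of classes; a minimal representative is a labeling in its class with the fewest $1$'s. -}

module Defs where

open import Data.Nat using (ℕ; zero; suc; _+_; _*_; _∸_; _≤_; _≡ᵇ_; _≤ᵇ_; _%_)
open import Data.Bool using (Bool; true; false; _∧_; _∨_; _xor_; not)
open import Data.Fin using (Fin; toℕ)
open import Data.Vec using (Vec; []; _∷_; lookup; tabulate; _[_]≔_; foldr′; allFin)
open import Data.List using (List; []; _∷_; length)
open import Data.Product using (Σ; ∃; _×_; _,_)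
open import Relation.Binary.PropositionalEquality using (_≡_)
open import Relation.Binary.Construct.Closure.Equivalence using (EqClosure)
open import Level using (0ℓ)
open import Relation.Binary.Core using (Rel)

-- A finite simple graph on vertex set Fin m, given by a Boolean adjacency
-- function (symmetric, irreflexive for the graphs used below).
Graph : ℕ → Set
Graph m = Fin m → Fin m → Bool

-- Labelings d : vertices → ℤ/2ℤ, with ℤ/2ℤ ≅ Bool (addition = xor).
Labeling : ℕ → Set
Labeling m = Vec Bool m

neighbourSum : ∀ {m} → Graph m → Labeling m → Fin m → Bool
neighbourSum G d i = foldr′ _xor_ false (tabulate (λ k → G i k ∧ Data.Vec.lookup d k))

move : ∀ {m} → Graph m → Fin m → Labeling m → Labeling m
move G i d = d [ i ]≔ (Data.Vec.lookup d i xor neighbourSum G d i)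

Step : ∀ {m} → Graph m → Rel (Labeling m) 0ℓ
Step G d d' = ∃ λ i → d' ≡ move G i d

Equiv : ∀ {m} → Graph m → Rel (Labeling m) 0ℓ
Equiv G = EqClosure (Step G)

weight : ∀ {m} → Labeling m → ℕ
weight [] = 0
weight (true ∷ d) = suc (weight d)
weight (false ∷ d) = weight d

-- #Cl(G) = N : there is a family of N labelings meeting every class
-- exactly once (i.e. a bijection Fin N ≅ Cl(G)).
ClassCount : ∀ {m} → Graph m → ℕ → Set
ClassCount {m} G N = Σ (Fin N → Labeling m) λ f →
  (∀ a b → Equiv G (f a) (f b) → a ≡ b) × (∀ d → ∃ λ a → Equiv G d (f a))

MinimalRepSystem : ∀ {m} → Graph m → List (Labeling m) → Set
MinimalRepSystem {m} G L =
  (∀ a b → Equiv G (Data.List.lookup L a) (Data.List.lookup L b) → a ≡ b)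
  × (∀ d → ∃ λ a → Equiv G d (Data.List.lookup L a))
  × (∀ a d → Equiv G d (Data.List.lookup L a) → weight (Data.List.lookup L a) ≤ weight d)

edgeℕ : ℕ → ℕ → ℕ → Bool
edgeℕ n a b =
     ((a ≡ᵇ 1) ∧ (b ≡ᵇ 2))
  ∨ ((a ≡ᵇ 0) ∧ (b ≡ᵇ 2))
  ∨ ((2 ≤ᵇ a) ∧ (b ≡ᵇ suc a) ∧ (b ≤ᵇ n ∸ 2))
  ∨ ((a ≡ᵇ n ∸ 2) ∧ (b ≡ᵇ n ∸ 1))
  ∨ ((a ≡ᵇ n ∸ 2) ∧ (b ≡ᵇ n))

Dtilde : (n : ℕ) → Graph (suc n)
Dtilde n i j = edgeℕ n (toℕ i) (toℕ j) ∨ edgeℕ n (toℕ j) (toℕ i)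

mkLab : (n : ℕ) → (ℕ → Bool) → Labeling (suc n)
mkLab n P = tabulate (λ j → P (toℕ j))

isEven isOdd : ℕ → Bool
isEven j = (j % 2) ≡ᵇ 0
isOdd j = not (isEven j)

ℓl : (n : ℕ) → Labeling (suc n)
ℓl n = mkLab n (λ j → j ≤ᵇ 1)

ℓr : (n : ℕ) → Labeling (suc n)
ℓr n = mkLab n (λ j → n ∸ 1 ≤ᵇ j)

ℓc : (n : ℕ) → Labeling (suc n)
ℓc n = mkLab n (λ j → (j ≤ᵇ 1) ∨ (n ∸ 1 ≤ᵇ j))

evens : ℕ → ℕ → Bool
evens i j = (2 ≤ᵇ j) ∧ (j ≤ᵇ 2 * i) ∧ isEven j

chain : (n k : ℕ) → List (Labeling (suc n))
chain n k = Data.List.map (λ i → mkLab n (evens i)) (Data.List.upTo k)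

oddExtra : (k : ℕ) → Labeling (suc (2 * k + 1))
oddExtra k = mkLab (2 * k + 1) (λ j → evens (k ∸ 1) j ∨ (j ≡ᵇ 2 * k))

evenExtra : (k a b : ℕ) → Labeling (suc (2 * k))
evenExtra k a b = mkLab (2 * k) (λ j →
  (j ≡ᵇ a) ∨ (j ≡ᵇ b) ∨ ((3 ≤ᵇ j) ∧ (j ≤ᵇ 2 * k ∸ 3) ∧ isOdd j))

repsEven : (k : ℕ) → List (Labeling (suc (2 * k)))
repsEven k = ℓl n ∷ ℓr n ∷ ℓc n ∷ (chain n k Data.List.++
  (evenExtra k 0 (n ∸ 1) ∷ evenExtra k 0 n ∷ evenExtra k 1 (n ∸ 1) ∷ evenExtra k 1 n ∷ []))
  where n = 2 * k

repsOdd : (k : ℕ) → List (Labeling (suc (2 * k + 1)))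
repsOdd k = ℓl n ∷ ℓr n ∷ ℓc n ∷ (chain n k Data.List.++ (oddExtra k ∷ []))
  where n = 2 * k + 1

-- Write n = N t = 5 + t and read a labeling d of D̃ₙ (vertices 0 … n) through its code, the word
-- of length n whose letter at c is d_c + d_{c+1}, plus d_0 when c = 1 and plus d_n when c = n - 2.
-- The code together with d_0 and d_n determines d, and the move at a vertex swaps two adjacent
-- letters of the code (letters 0, 1 for the vertices 0 and 1, letters j - 1, j for 2 ≤ j ≤ n - 2,
-- letters n - 2, n - 1 for the vertices n - 1 and n); the moves at 0 and at n moreover change d_0,
-- resp. d_n, by the sum of the two swapped letters.  Hence the number w of ones in the code is an
-- invariant, and it is even because the letters sum to 0.  If the code is constant (w = 0 or w = n)
-- no move changes anything, so these classes are singletons, one for each value of (d_0 , d_n).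
-- Otherwise adjacent swaps sort the code and the moves at 0 and n then flip d_0 and d_n at will, so
-- w alone determines the class.  Every vertex feeds at most two letters, so w ≤ 2 · weight d and a
-- labeling of weight w / 2 is minimal in its class.  Counting the possible w gives 4 + (k - 1) + 4
-- classes for n = 2k and 4 + k classes for n = 2k + 1.

module Submission where

open import Defs
open import Data.Nat using (ℕ; zero; suc; _+_; _*_; _∸_; _≤_; _<_; z≤n; s≤s; _≡ᵇ_; _≤ᵇ_; _<ᵇ_; _%_; _≟_; _<?_; _≤?_; ⌊_/2⌋)
open import Data.Nat.Properties
open import Data.Nat.DivMod using ([m+n]%n≡m%n)
open import Data.Nat.Tactic.RingSolver using (solve-∀)
open import Data.Bool using (Bool; true; false; _∧_; _∨_; _xor_; not; T; if_then_else_)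
open import Data.Bool.Properties
  using (T-≡; T-∧; T-∨; ∧-comm; ∧-distribʳ-xor; ∧-identityʳ; ∧-zeroʳ; ∨-zeroʳ; ∨-identityʳ; xor-assoc; xor-comm; xor-identityʳ; xor-inverseʳ; xor-same)
import Data.Bool.Properties as BP
open import Data.Fin using (Fin; toℕ; fromℕ<; cast) renaming (zero to fz; suc to fs)
open import Data.Fin.Properties using (toℕ<n; toℕ-fromℕ<; toℕ-injective; toℕ-cast; cast-involutive)
open import Data.Vec using (Vec; []; _∷_; lookup; tabulate; _[_]≔_; foldr′)
open import Data.List using (List; []; _∷_; length; map; _++_; applyUpTo; upTo)
import Data.List as List
open import Data.List.Properties using (length-++; length-map; length-upTo)
open import Data.Product using (Σ; _×_; _,_; proj₁; proj₂; uncurry)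
open import Data.Sum using (_⊎_; inj₁; inj₂)
open import Data.Empty using (⊥; ⊥-elim)
open import Function.Base using (_∘_; case_of_)
open import Function.Bundles using (Equivalence)
open import Relation.Nullary using (yes; no; ¬_)
open import Relation.Binary.PropositionalEquality
open import Relation.Binary.Definitions using (tri<; tri≈; tri>)
open import Relation.Binary.Construct.Closure.ReflexiveTransitive using (ε; _◅_; _◅◅_)
open import Relation.Binary.Construct.Closure.Symmetric using (fwd; bwd)
open import Algebra.Properties.CommutativeSemigroup +-commutativeSemigroup using () renaming (interchange to +-interchange)
open import Algebra.Solver.Ring.AlmostCommutativeRing using (fromCommutativeRing)
import Algebra.Solver.Ring.Simple as RingSolver

open Equivalence using (to; from)

module XorSolver = RingSolver (fromCommutativeRing BP.xor-∧-commutativeRing) Data.Bool._≟_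
open XorSolver using (_:+_; _:*_; _:=_; con)

-- Positions past the end read as false.
lookupℕ : ∀ {m} → Vec Bool m → ℕ → Bool
lookupℕ []      x       = false
lookupℕ (b ∷ v) zero    = b
lookupℕ (b ∷ v) (suc x) = lookupℕ v x

lookup≡lookupℕ : ∀ {m} (v : Vec Bool m) (i : Fin m) → lookup v i ≡ lookupℕ v (toℕ i)
lookup≡lookupℕ (b ∷ v) fz     = refl
lookup≡lookupℕ (b ∷ v) (fs i) = lookup≡lookupℕ v i

lookupℕ-[]≔ : ∀ {m} (v : Vec Bool m) (i : Fin m) (y : Bool) x →
  lookupℕ (v [ i ]≔ y) x ≡ (if x ≡ᵇ toℕ i then y else lookupℕ v x)
lookupℕ-[]≔ (b ∷ v) fz     y zero    = refl
lookupℕ-[]≔ (b ∷ v) fz     y (suc x) = refl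
lookupℕ-[]≔ (b ∷ v) (fs i) y zero    = refl
lookupℕ-[]≔ (b ∷ v) (fs i) y (suc x) = lookupℕ-[]≔ v i y x

lookupℕ-tabulate : ∀ m (P : ℕ → Bool) x → x < m → lookupℕ (tabulate {n = m} (λ k → P (toℕ k))) x ≡ P x
lookupℕ-tabulate (suc m) P zero    _         = refl
lookupℕ-tabulate (suc m) P (suc x) (s≤s x<m) = lookupℕ-tabulate m (λ y → P (suc y)) x x<m

lookupℕ-ext : ∀ {m} (v w : Vec Bool m) → (∀ x → x < m → lookupℕ v x ≡ lookupℕ w x) → v ≡ w
lookupℕ-ext []      []      _ = refl
lookupℕ-ext (a ∷ v) (b ∷ w) h = cong₂ _∷_ (h 0 (s≤s z≤n)) (lookupℕ-ext v w (λ x x<m → h (suc x) (s≤s x<m)))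

≡ᵇ-refl : ∀ a → (a ≡ᵇ a) ≡ true
≡ᵇ-refl zero    = refl
≡ᵇ-refl (suc a) = ≡ᵇ-refl a

≡ᵇ-false : ∀ a b → a ≢ b → (a ≡ᵇ b) ≡ false
≡ᵇ-false zero    zero    a≢b = ⊥-elim (a≢b refl)
≡ᵇ-false zero    (suc b) _   = refl
≡ᵇ-false (suc a) zero    _   = refl
≡ᵇ-false (suc a) (suc b) a≢b = ≡ᵇ-false a b (λ e → a≢b (cong suc e))

<ᵇ-true : ∀ {c w} → c < w → (c <ᵇ w) ≡ true
<ᵇ-true c<w = to T-≡ (<⇒<ᵇ c<w)

<ᵇ-false : ∀ {c w} → w ≤ c → (c <ᵇ w) ≡ false
<ᵇ-false {c} {w} w≤c with c <ᵇ w in e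
... | false = refl
... | true  = ⊥-elim (<⇒≱ (<ᵇ⇒< c w (from T-≡ e)) w≤c)

≤ᵇ-true : ∀ {c w} → c ≤ w → (c ≤ᵇ w) ≡ true
≤ᵇ-true c≤w = to T-≡ (≤⇒≤ᵇ c≤w)

≤ᵇ-false : ∀ {c w} → w < c → (c ≤ᵇ w) ≡ false
≤ᵇ-false {c} {w} w<c with c ≤ᵇ w in e
... | false = refl
... | true  = ⊥-elim (<⇒≱ w<c (≤ᵇ⇒≤ c w (from T-≡ e)))

n≢1+n : ∀ n → n ≢ suc n
n≢1+n n = <⇒≢ (n<1+n n)

true≢false : true ≢ false
true≢false ()

∨-introˡ : ∀ x y → T x → T (x ∨ y)
∨-introˡ x y = from (T-∨ {x} {y}) ∘ inj₁

∨-introʳ : ∀ x y → T y → T (x ∨ y)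
∨-introʳ x y = from (T-∨ {x} {y}) ∘ inj₂

xor-false∧ : ∀ a b s → b ≡ false → a xor (b ∧ s) ≡ a
xor-false∧ a .false s refl = xor-identityʳ a

xor-true∧ : ∀ a b s → b ≡ true → s ≡ true → a xor (b ∧ s) ≡ not a
xor-true∧ true  .true .true refl refl = refl
xor-true∧ false .true .true refl refl = refl

indicator₁ : ∀ (f : ℕ → Bool) a → (∀ x → T (f x) → x ≡ a) → T (f a) → ∀ x → f x ≡ (x ≡ᵇ a)
indicator₁ f a supp fa x with f x in eq
... | true with supp x (from T-≡ eq)
...   | refl = sym (≡ᵇ-refl a)
indicator₁ f a supp fa x | false = sym (≡ᵇ-false x a (λ { refl → subst T eq fa }))

indicator₂ : ∀ (f : ℕ → Bool) a b → a ≢ b → (∀ x → T (f x) → x ≡ a ⊎ x ≡ b) → T (f a) → T (f b) →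
  ∀ x → f x ≡ ((x ≡ᵇ a) xor (x ≡ᵇ b))
indicator₂ f a b a≢b supp fa fb x with f x in eq
... | true with supp x (from T-≡ eq)
...   | inj₁ refl rewrite ≡ᵇ-refl a | ≡ᵇ-false a b a≢b = refl
...   | inj₂ refl rewrite ≡ᵇ-refl b | ≡ᵇ-false b a (≢-sym a≢b) = refl
indicator₂ f a b a≢b supp fa fb x | false
  rewrite ≡ᵇ-false x a (λ { refl → subst T eq fa }) | ≡ᵇ-false x b (λ { refl → subst T eq fb }) = refl

indicator₃ : ∀ (f : ℕ → Bool) a b c → a ≢ b → a ≢ c → b ≢ c →
  (∀ x → T (f x) → x ≡ a ⊎ x ≡ b ⊎ x ≡ c) → T (f a) → T (f b) → T (f c) →
  ∀ x → f x ≡ ((x ≡ᵇ a) xor (x ≡ᵇ b) xor (x ≡ᵇ c))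
indicator₃ f a b c a≢b a≢c b≢c supp fa fb fc x with f x in eq
... | true with supp x (from T-≡ eq)
...   | inj₁ refl        rewrite ≡ᵇ-refl a | ≡ᵇ-false a b a≢b | ≡ᵇ-false a c a≢c = refl
...   | inj₂ (inj₁ refl) rewrite ≡ᵇ-refl b | ≡ᵇ-false b a (≢-sym a≢b) | ≡ᵇ-false b c b≢c = refl
...   | inj₂ (inj₂ refl) rewrite ≡ᵇ-refl c | ≡ᵇ-false c a (≢-sym a≢c) | ≡ᵇ-false c b (≢-sym b≢c) = refl
indicator₃ f a b c a≢b a≢c b≢c supp fa fb fc x | false
  rewrite ≡ᵇ-false x a (λ { refl → subst T eq fa }) | ≡ᵇ-false x b (λ { refl → subst T eq fb })
        | ≡ᵇ-false x c (λ { refl → subst T eq fc }) = refl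

only-at : ∀ (P : ℕ → Bool) b → P b ≡ false → ∀ x → (x ≡ᵇ b) ∧ P x ≡ false
only-at P b Pb≡false x with x ≡ᵇ b in x≡b
... | false = refl
... | true rewrite ≡ᵇ⇒≡ x b (from T-≡ x≡b) = Pb≡false

xorSum : ℕ → (ℕ → Bool) → Bool
xorSum zero    f = false
xorSum (suc m) f = f 0 xor xorSum m (λ x → f (suc x))

xorSum-cong : ∀ m {f g : ℕ → Bool} → (∀ x → x < m → f x ≡ g x) → xorSum m f ≡ xorSum m g
xorSum-cong zero    h = refl
xorSum-cong (suc m) h = cong₂ _xor_ (h 0 (s≤s z≤n)) (xorSum-cong m (λ x x<m → h (suc x) (s≤s x<m)))

xorSum-false : ∀ m → xorSum m (λ _ → false) ≡ false
xorSum-false zero    = refl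
xorSum-false (suc m) = xorSum-false m

xorSum-xor : ∀ m f g → xorSum m (λ x → f x xor g x) ≡ xorSum m f xor xorSum m g
xorSum-xor zero    f g = refl
xorSum-xor (suc m) f g rewrite xorSum-xor m (λ x → f (suc x)) (λ x → g (suc x)) =
  XorSolver.solve 4 (λ a b c d → (a :+ b) :+ (c :+ d) := (a :+ c) :+ (b :+ d)) refl
    (f 0) (g 0) (xorSum m (λ x → f (suc x))) (xorSum m (λ x → g (suc x)))

xorSum-indicator : ∀ m a (g : ℕ → Bool) → a < m → xorSum m (λ x → (x ≡ᵇ a) ∧ g x) ≡ g a
xorSum-indicator (suc m) zero    g _         rewrite xorSum-false m = xor-identityʳ (g 0)
xorSum-indicator (suc m) (suc a) g (s≤s a<m) = xorSum-indicator m a (λ x → g (suc x)) a<m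

xorSum-telescope : ∀ m (D : ℕ → Bool) → xorSum m (λ c → D c xor D (suc c)) ≡ D 0 xor D m
xorSum-telescope zero    D = sym (BP.xor-same (D 0))
xorSum-telescope (suc m) D rewrite xorSum-telescope m (λ c → D (suc c)) =
  XorSolver.solve 3 (λ a b c → (a :+ b) :+ (b :+ c) := a :+ c) refl (D 0) (D 1) (D (suc m))

xorSum-support₁ : ∀ m (f D : ℕ → Bool) a → a < m → (∀ x → T (f x) → x ≡ a) → T (f a) →
  xorSum m (λ x → f x ∧ D x) ≡ D a
xorSum-support₁ m f D a a<m supp fa =
  trans (xorSum-cong m (λ x _ → cong (_∧ D x) (indicator₁ f a supp fa x))) (xorSum-indicator m a D a<m)

xorSum-support₂ : ∀ m (f D : ℕ → Bool) a b → a < m → b < m → a ≢ b →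
  (∀ x → T (f x) → x ≡ a ⊎ x ≡ b) → T (f a) → T (f b) → xorSum m (λ x → f x ∧ D x) ≡ D a xor D b
xorSum-support₂ m f D a b a<m b<m a≢b supp fa fb = begin
  xorSum m (λ x → f x ∧ D x)
    ≡⟨ xorSum-cong m (λ x _ → trans (cong (_∧ D x) (indicator₂ f a b a≢b supp fa fb x)) (∧-distribʳ-xor (D x) (x ≡ᵇ a) (x ≡ᵇ b))) ⟩
  xorSum m (λ x → ((x ≡ᵇ a) ∧ D x) xor ((x ≡ᵇ b) ∧ D x))
    ≡⟨ xorSum-xor m (λ x → (x ≡ᵇ a) ∧ D x) (λ x → (x ≡ᵇ b) ∧ D x) ⟩
  xorSum m (λ x → (x ≡ᵇ a) ∧ D x) xor xorSum m (λ x → (x ≡ᵇ b) ∧ D x)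
    ≡⟨ cong₂ _xor_ (xorSum-indicator m a D a<m) (xorSum-indicator m b D b<m) ⟩
  D a xor D b ∎
  where open ≡-Reasoning

xorSum-support₃ : ∀ m (f D : ℕ → Bool) a b c → a < m → b < m → c < m → a ≢ b → a ≢ c → b ≢ c →
  (∀ x → T (f x) → x ≡ a ⊎ x ≡ b ⊎ x ≡ c) → T (f a) → T (f b) → T (f c) →
  xorSum m (λ x → f x ∧ D x) ≡ D a xor D b xor D c
xorSum-support₃ m f D a b c a<m b<m c<m a≢b a≢c b≢c supp fa fb fc = begin
  xorSum m (λ x → f x ∧ D x)
    ≡⟨ xorSum-cong m (λ x _ → trans (cong (_∧ D x) (indicator₃ f a b c a≢b a≢c b≢c supp fa fb fc x))
         (trans (∧-distribʳ-xor (D x) (x ≡ᵇ a) _) (cong (((x ≡ᵇ a) ∧ D x) xor_) (∧-distribʳ-xor (D x) (x ≡ᵇ b) (x ≡ᵇ c))))) ⟩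
  xorSum m (λ x → ((x ≡ᵇ a) ∧ D x) xor (((x ≡ᵇ b) ∧ D x) xor ((x ≡ᵇ c) ∧ D x)))
    ≡⟨ trans (xorSum-xor m (λ x → (x ≡ᵇ a) ∧ D x) _)
         (cong (xorSum m (λ x → (x ≡ᵇ a) ∧ D x) xor_) (xorSum-xor m (λ x → (x ≡ᵇ b) ∧ D x) (λ x → (x ≡ᵇ c) ∧ D x))) ⟩
  xorSum m (λ x → (x ≡ᵇ a) ∧ D x) xor (xorSum m (λ x → (x ≡ᵇ b) ∧ D x) xor xorSum m (λ x → (x ≡ᵇ c) ∧ D x))
    ≡⟨ cong₂ _xor_ (xorSum-indicator m a D a<m) (cong₂ _xor_ (xorSum-indicator m b D b<m) (xorSum-indicator m c D c<m)) ⟩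
  D a xor D b xor D c ∎
  where open ≡-Reasoning

foldr-xor-tabulate : ∀ m (g : Fin m → Bool) (h : ℕ → Bool) → (∀ k → g k ≡ h (toℕ k)) →
  foldr′ _xor_ false (tabulate g) ≡ xorSum m h
foldr-xor-tabulate zero    g h e = refl
foldr-xor-tabulate (suc m) g h e =
  cong₂ _xor_ (e fz) (foldr-xor-tabulate m (λ k → g (fs k)) (λ x → h (suc x)) (λ k → e (fs k)))

sumTo : ℕ → (ℕ → ℕ) → ℕ
sumTo zero    g = 0
sumTo (suc m) g = g 0 + sumTo m (λ c → g (suc c))

sumTo-cong : ∀ m {f g : ℕ → ℕ} → (∀ c → c < m → f c ≡ g c) → sumTo m f ≡ sumTo m g
sumTo-cong zero    h = refl
sumTo-cong (suc m) h = cong₂ _+_ (h 0 (s≤s z≤n)) (sumTo-cong m (λ c c<m → h (suc c) (s≤s c<m)))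

sumTo-mono : ∀ m {f g : ℕ → ℕ} → (∀ c → c < m → f c ≤ g c) → sumTo m f ≤ sumTo m g
sumTo-mono zero    h = z≤n
sumTo-mono (suc m) h = +-mono-≤ (h 0 (s≤s z≤n)) (sumTo-mono m (λ c c<m → h (suc c) (s≤s c<m)))

sumTo-0 : ∀ m → sumTo m (λ _ → 0) ≡ 0
sumTo-0 zero    = refl
sumTo-0 (suc m) = sumTo-0 m

sumTo-+ : ∀ m f g → sumTo m (λ c → f c + g c) ≡ sumTo m f + sumTo m g
sumTo-+ zero    f g = refl
sumTo-+ (suc m) f g rewrite sumTo-+ m (λ c → f (suc c)) (λ c → g (suc c)) =
  +-interchange (f 0) (g 0) (sumTo m (λ c → f (suc c))) (sumTo m (λ c → g (suc c)))

sumTo-snoc : ∀ m g → sumTo (suc m) g ≡ sumTo m g + g m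
sumTo-snoc zero    g = +-comm (g 0) 0
sumTo-snoc (suc m) g rewrite sumTo-snoc m (λ c → g (suc c)) = sym (+-assoc (g 0) _ _)

sumTo-tail-0 : ∀ m k (g : ℕ → ℕ) → (∀ x → m ≤ x → g x ≡ 0) → sumTo (m + k) g ≡ sumTo m g
sumTo-tail-0 zero    k g h = trans (sumTo-cong k (λ x _ → h x z≤n)) (sumTo-0 k)
sumTo-tail-0 (suc m) k g h = cong (g 0 +_) (sumTo-tail-0 m k (λ x → g (suc x)) (λ x m≤x → h (suc x) (s≤s m≤x)))

sumTo-exchange : ∀ m p (f g : ℕ → ℕ) → suc p < m → (∀ c → c < m → c ≢ p → c ≢ suc p → f c ≡ g c) →
  sumTo m f + (g p + g (suc p)) ≡ sumTo m g + (f p + f (suc p))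
sumTo-exchange (suc (suc m)) zero f g _ h
  rewrite sumTo-cong m {λ c → f (suc (suc c))} {λ c → g (suc (suc c))}
            (λ c c<m → h (suc (suc c)) (s≤s (s≤s c<m)) (λ ()) (λ ())) =
  rearrange (f 0) (f 1) (g 0) (g 1) (sumTo m (λ c → g (suc (suc c))))
  where
  rearrange : ∀ a b c d s → a + (b + s) + (c + d) ≡ c + (d + s) + (a + b)
  rearrange = solve-∀
sumTo-exchange (suc m) (suc p) f g (s≤s p+1<m) h rewrite h 0 (s≤s z≤n) (λ ()) (λ ()) =
  trans (+-assoc (g 0) _ _) (trans (cong (g 0 +_) ih) (sym (+-assoc (g 0) _ _)))
  where
  ih = sumTo-exchange m p (λ c → f (suc c)) (λ c → g (suc c)) p+1<m
         (λ c c<m c≢p c≢p+1 → h (suc c) (s≤s c<m) (c≢p ∘ suc-injective) (c≢p+1 ∘ suc-injective))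

bit : Bool → ℕ
bit true  = 1
bit false = 0

bit≤1 : ∀ b → bit b ≤ 1
bit≤1 true  = ≤-refl
bit≤1 false = z≤n

bit-xor : ∀ a b → bit (a xor b) ≤ bit a + bit b
bit-xor false b     = ≤-refl
bit-xor true  false = ≤-refl
bit-xor true  true  = z≤n

bit-∨ : ∀ a b → a ∧ b ≡ false → bit (a ∨ b) ≡ bit a + bit b
bit-∨ false b     _ = refl
bit-∨ true  false _ = refl

sumTo-indicator : ∀ m a v → a < m → sumTo m (λ c → bit ((c ≡ᵇ a) ∧ v)) ≡ bit v
sumTo-indicator (suc m) zero    v _         rewrite sumTo-0 m = +-identityʳ _
sumTo-indicator (suc m) (suc a) v (s≤s a<m) = sumTo-indicator m a v a<m

weight≡sumTo : ∀ {m} (v : Vec Bool m) → weight v ≡ sumTo m (λ x → bit (lookupℕ v x))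
weight≡sumTo []          = refl
weight≡sumTo (true ∷ v)  = cong suc (weight≡sumTo v)
weight≡sumTo (false ∷ v) = weight≡sumTo v

count : ℕ → (ℕ → Bool) → ℕ
count m f = sumTo m (λ c → bit (f c))

count-cong : ∀ m {f g : ℕ → Bool} → (∀ c → c < m → f c ≡ g c) → count m f ≡ count m g
count-cong m h = sumTo-cong m (λ c c<m → cong bit (h c c<m))

count≤ : ∀ m f → count m f ≤ m
count≤ zero    f = z≤n
count≤ (suc m) f = +-mono-≤ (bit≤1 (f 0)) (count≤ m (λ c → f (suc c)))

count-false : ∀ m f → (∀ c → c < m → f c ≡ false) → count m f ≡ 0
count-false zero    f h = refl
count-false (suc m) f h rewrite h 0 (s≤s z≤n) = count-false m (λ c → f (suc c)) (λ c c<m → h (suc c) (s≤s c<m))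

count-true : ∀ m → count m (λ _ → true) ≡ m
count-true zero    = refl
count-true (suc m) = cong suc (count-true m)

count≡0⇒false : ∀ m f → count m f ≡ 0 → ∀ c → c < m → f c ≡ false
count≡0⇒false (suc m) f e zero    _ with f 0 | e
... | false | _ = refl
count≡0⇒false (suc m) f e (suc c) (s≤s c<m) with f 0 | e
... | false | e′ = count≡0⇒false m (λ c → f (suc c)) e′ c c<m

count≡m⇒true : ∀ m f → count m f ≡ m → ∀ c → c < m → f c ≡ true
count≡m⇒true (suc m) f e c c<m with f 0 in f0
count≡m⇒true (suc m) f e c       c<m       | false = ⊥-elim (<-irrefl e (s≤s (count≤ m (λ c → f (suc c)))))
count≡m⇒true (suc m) f e zero    _         | true  = f0
count≡m⇒true (suc m) f e (suc c) (s≤s c<m) | true  = count≡m⇒true m (λ c → f (suc c)) (suc-injective e) c c<m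

count-parity : ∀ m f → Σ ℕ λ h → count m f ≡ bit (xorSum m f) + 2 * h
count-parity zero    f = 0 , refl
count-parity (suc m) f with count-parity m (λ c → f (suc c))
... | h , e with f 0 | xorSum m (λ c → f (suc c))
... | false | _     = h , e
... | true  | false = h , cong suc e
... | true  | true  = suc h , trans (cong suc e) (sym (*-suc 2 h))

count-prefix : ∀ m w → w ≤ m → count m (λ c → c <ᵇ w) ≡ w
count-prefix m       zero    _         = count-false m (λ c → c <ᵇ 0) (λ c _ → refl)
count-prefix (suc m) (suc w) (s≤s w≤m) = cong suc (count-prefix m w w≤m)

swap : ℕ → ℕ → ℕ
swap p c = if c ≡ᵇ p then suc p else (if c ≡ᵇ suc p then p else c)

swap-p : ∀ p → swap p p ≡ suc p
swap-p p rewrite ≡ᵇ-refl p = refl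

swap-1+p : ∀ p → swap p (suc p) ≡ p
swap-1+p p rewrite ≡ᵇ-false (suc p) p (≢-sym (n≢1+n p)) | ≡ᵇ-refl p = refl

swap-other : ∀ p c → c ≢ p → c ≢ suc p → swap p c ≡ c
swap-other p c c≢p c≢p+1 rewrite ≡ᵇ-false c p c≢p | ≡ᵇ-false c (suc p) c≢p+1 = refl

swap-involutive : ∀ p c → swap p (swap p c) ≡ c
swap-involutive p c with c ≡ᵇ p in e₁
... | true rewrite ≡ᵇ⇒≡ c p (from T-≡ e₁) = swap-1+p p
... | false with c ≡ᵇ suc p in e₂
...   | true rewrite ≡ᵇ⇒≡ c (suc p) (from T-≡ e₂) = swap-p p
...   | false rewrite e₁ | e₂ = refl

swap-< : ∀ m p c → suc p < m → c < m → swap p c < m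
swap-< m p c p+1<m c<m with c ≡ᵇ p
... | true = p+1<m
... | false with c ≡ᵇ suc p
...   | true  = ≤-trans (n≤1+n _) p+1<m
...   | false = c<m

count-swap : ∀ m p (f : ℕ → Bool) → suc p < m → count m (λ c → f (swap p c)) ≡ count m f
count-swap m p f p+1<m = +-cancelʳ-≡ (bit (f p) + bit (f (suc p))) _ _ (begin
  count m (λ c → f (swap p c)) + (bit (f p) + bit (f (suc p)))
    ≡⟨ sumTo-exchange m p _ _ p+1<m (λ c _ c≢p c≢p+1 → cong (λ z → bit (f z)) (swap-other p c c≢p c≢p+1)) ⟩
  count m f + (bit (f (swap p p)) + bit (f (swap p (suc p))))
    ≡⟨ cong₂ (λ a b → count m f + (bit (f a) + bit (f b))) (swap-p p) (swap-1+p p) ⟩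
  count m f + (bit (f (suc p)) + bit (f p))
    ≡⟨ cong (count m f +_) (+-comm (bit (f (suc p))) (bit (f p))) ⟩
  count m f + (bit (f p) + bit (f (suc p))) ∎)
  where open ≡-Reasoning

positionSum : ℕ → (ℕ → Bool) → ℕ
positionSum m f = sumTo m (λ c → if f c then c else 0)

positionSum-swap : ∀ m p (f : ℕ → Bool) → suc p < m → f p ≡ false → f (suc p) ≡ true →
  positionSum m (λ c → f (swap p c)) < positionSum m f
positionSum-swap m p f p+1<m fp fp+1 =
  +-cancelʳ-< p _ _ (≤-reflexive (trans (sym (+-suc _ p)) (trans exchanged (cong (_ +_) (+-identityʳ p)))))
  where
  F G : ℕ → ℕ
  F c = if f (swap p c) then c else 0
  G c = if f c then c else 0
  Fp : F p ≡ p
  Fp rewrite swap-p p | fp+1 = refl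
  Fp+1 : F (suc p) ≡ 0
  Fp+1 rewrite swap-1+p p | fp = refl
  G-pair : G p + G (suc p) ≡ suc p
  G-pair rewrite fp | fp+1 = refl
  exchanged : sumTo m F + suc p ≡ sumTo m G + (p + 0)
  exchanged = subst₂ (λ a b → sumTo m F + a ≡ sumTo m G + b) G-pair (cong₂ _+_ Fp Fp+1)
    (sumTo-exchange m p F G p+1<m (λ c _ c≢p c≢p+1 → cong (λ z → if f z then c else 0) (swap-other p c c≢p c≢p+1)))

Sorted : ℕ → (ℕ → Bool) → Set
Sorted m f = ∀ p → suc p < m → f p ≡ false → f (suc p) ≡ false

ascent-or-Sorted : ∀ m f → (Σ ℕ λ p → suc p < m × f p ≡ false × f (suc p) ≡ true) ⊎ Sorted m f
ascent-or-Sorted zero    f = inj₂ (λ p ())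
ascent-or-Sorted (suc m) f with ascent-or-Sorted m (λ c → f (suc c))
... | inj₁ (p , p+1<m , fp , fp+1) = inj₁ (suc p , s≤s p+1<m , fp , fp+1)
... | inj₂ sorted with m
...   | zero = inj₂ (λ { p (s≤s ()) })
...   | suc _ with f 0 in f0 | f 1 in f1
...     | false | true  = inj₁ (0 , s≤s (s≤s z≤n) , f0 , f1)
...     | true  | _     = inj₂ (λ { zero _ f0≡false → ⊥-elim (true≢false (trans (sym f0) f0≡false))
                                  ; (suc p) p+2<m fp → sorted p (≤-pred p+2<m) fp })
...     | false | false = inj₂ (λ { zero _ _ → f1 ; (suc p) p+2<m fp → sorted p (≤-pred p+2<m) fp })

Sorted-false : ∀ m f → Sorted m f → f 0 ≡ false → ∀ c → c < m → f c ≡ false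
Sorted-false m f sorted f0 zero    _   = f0
Sorted-false m f sorted f0 (suc c) c<m = sorted c c<m (Sorted-false m f sorted f0 c (≤-trans (n≤1+n _) c<m))

Sorted⇒prefix : ∀ m f → Sorted m f → ∀ c → c < m → f c ≡ (c <ᵇ count m f)
Sorted⇒prefix (suc m) f sorted c c<m with f 0 in f0
... | false rewrite count-false m (λ c → f (suc c)) (λ c c<m → Sorted-false (suc m) f sorted f0 (suc c) (s≤s c<m)) with c
...   | zero   = f0
...   | suc c′ = Sorted-false (suc m) f sorted f0 (suc c′) c<m
Sorted⇒prefix (suc m) f sorted zero    _         | true = f0
Sorted⇒prefix (suc m) f sorted (suc c) (s≤s c<m) | true =
  Sorted⇒prefix m (λ c → f (suc c)) (λ p p+1<m fp → sorted (suc p) (s≤s p+1<m) fp) c c<m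

holed : ℕ → ℕ → ℕ → Bool
holed w m c = (c ≤ᵇ w) ∧ not (c ≡ᵇ m)

prefixPlus : ℕ → ℕ → ℕ → Bool
prefixPlus a m c = (c <ᵇ a) ∨ (c ≡ᵇ m)

count-holed : ∀ m w → w < m → count m (holed w 0) ≡ w
count-holed (suc m) w (s≤s w≤m) = trans (count-cong m (λ c _ → BP.∧-identityʳ (suc c ≤ᵇ w))) (count-prefix m w w≤m)

holed-swap : ∀ w m c → suc m ≤ w → holed w (suc m) (swap m c) ≡ holed w m c
holed-swap w m c m<w with c ≟ m
... | yes refl rewrite swap-p m | ≡ᵇ-refl m = trans (∧-zeroʳ _) (sym (∧-zeroʳ _))
... | no c≢m with c ≟ suc m
...   | yes refl rewrite swap-1+p m | ≡ᵇ-false m (suc m) (n≢1+n m) | ≡ᵇ-false (suc m) m (≢-sym (n≢1+n m))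
                       | ≤ᵇ-true m<w | ≤ᵇ-true (≤-trans (n≤1+n m) m<w) = refl
...   | no c≢m+1 rewrite swap-other m c c≢m c≢m+1 | ≡ᵇ-false c m c≢m | ≡ᵇ-false c (suc m) c≢m+1 = refl

prefixPlus-swap : ∀ a m c → a ≤ m → prefixPlus a m (swap m c) ≡ prefixPlus a (suc m) c
prefixPlus-swap a m c a≤m with c ≟ m
... | yes refl rewrite swap-p m | ≡ᵇ-false m (suc m) (n≢1+n m) | ≡ᵇ-false (suc m) m (≢-sym (n≢1+n m))
                     | <ᵇ-false {suc m} {a} (≤-trans a≤m (n≤1+n m)) | <ᵇ-false {m} {a} a≤m = refl
... | no c≢m with c ≟ suc m
...   | yes refl rewrite swap-1+p m | ≡ᵇ-refl m = trans (∨-zeroʳ _) (sym (∨-zeroʳ _))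
...   | no c≢m+1 rewrite swap-other m c c≢m c≢m+1 | ≡ᵇ-false c m c≢m | ≡ᵇ-false c (suc m) c≢m+1 = refl

prefix≡holed : ∀ w c → (c <ᵇ w) ≡ holed w w c
prefix≡holed w c with <-cmp c w
... | tri< c<w _ _ rewrite <ᵇ-true c<w | ≤ᵇ-true (<⇒≤ c<w) | ≡ᵇ-false c w (<⇒≢ c<w) = refl
... | tri≈ _ refl _ rewrite <ᵇ-false {c} {c} ≤-refl | ≡ᵇ-refl c = sym (∧-zeroʳ _)
... | tri> _ _ w<c rewrite <ᵇ-false (<⇒≤ w<c) | ≤ᵇ-false w<c = refl

prefix≡prefixPlus : ∀ a c → (c <ᵇ suc a) ≡ prefixPlus a a c
prefix≡prefixPlus a c with <-cmp c a
... | tri< c<a _ _ rewrite <ᵇ-true c<a | <ᵇ-true (≤-trans c<a (n≤1+n a)) = refl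
... | tri≈ _ refl _ rewrite <ᵇ-true (≤-refl {suc c}) | ≡ᵇ-refl c = sym (∨-zeroʳ _)
... | tri> _ _ a<c rewrite <ᵇ-false (<⇒≤ a<c) | <ᵇ-false {c} {suc a} a<c | ≡ᵇ-false c a (≢-sym (<⇒≢ a<c)) = refl

isEven-2+ : ∀ j → isEven (suc (suc j)) ≡ isEven j
isEven-2+ j = cong (_≡ᵇ 0) (trans (cong (_% 2) (+-comm 2 j)) ([m+n]%n≡m%n j 2))

isEven-suc : ∀ j → isEven (suc j) ≡ not (isEven j)
isEven-suc zero          = refl
isEven-suc (suc zero)    = refl
isEven-suc (suc (suc j)) = trans (isEven-2+ (suc j)) (trans (isEven-suc j) (cong not (sym (isEven-2+ j))))

isOdd-suc : ∀ j → isOdd (suc j) ≡ not (isOdd j)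
isOdd-suc j = cong not (isEven-suc j)

isEven-2* : ∀ i → isEven (2 * i) ≡ true
isEven-2* zero    = refl
isEven-2* (suc i) = trans (cong isEven (*-suc 2 i)) (trans (isEven-2+ (2 * i)) (isEven-2* i))

⌊2*n/2⌋≡n : ∀ n → ⌊ 2 * n /2⌋ ≡ n
⌊2*n/2⌋≡n zero    = refl
⌊2*n/2⌋≡n (suc n) = trans (cong ⌊_/2⌋ (*-suc 2 n)) (cong suc (⌊2*n/2⌋≡n n))

Equiv-invariant : ∀ {m} (G : Graph m) {A : Set} (f : Labeling m → A) →
  (∀ i d → f (move G i d) ≡ f d) → ∀ {d d′} → Equiv G d d′ → f d ≡ f d′
Equiv-invariant G f f-move ε                        = refl
Equiv-invariant G f f-move (fwd (i , refl) ◅ steps) = trans (sym (f-move i _)) (Equiv-invariant G f f-move steps)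
Equiv-invariant G f f-move (bwd (i , refl) ◅ steps) = trans (f-move i _) (Equiv-invariant G f f-move steps)

Enumerates : ∀ {X : Set} → List X → (ℕ → X) → Set
Enumerates xs f = ∀ a → List.lookup xs a ≡ f (toℕ a)

enumerates-[] : ∀ {X : Set} (f : ℕ → X) → Enumerates [] f
enumerates-[] f ()

enumerates-∷ : ∀ {X : Set} {x : X} {xs} (f : ℕ → X) → x ≡ f 0 → Enumerates xs (λ j → f (suc j)) → Enumerates (x ∷ xs) f
enumerates-∷ f x≡f0 _    fz     = x≡f0
enumerates-∷ f _    rest (fs a) = rest a

enumerates-map-upTo-++ : ∀ {X : Set} (g : ℕ → X) k ys (f : ℕ → X) → (∀ i → i < k → g i ≡ f i) →
  Enumerates ys (λ j → f (k + j)) → Enumerates (map g (upTo k) ++ ys) f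
enumerates-map-upTo-++ g k ys f g≗f rest = go k (λ i → i) f g≗f rest
  where
  go : ∀ k (h : ℕ → ℕ) (f : ℕ → _) → (∀ i → i < k → g (h i) ≡ f i) → Enumerates ys (λ j → f (k + j)) →
    Enumerates (map g (applyUpTo h k) ++ ys) f
  go zero    h f _    rest = rest
  go (suc k) h f g≗f rest = enumerates-∷ f (g≗f 0 (s≤s z≤n)) (go k (λ i → h (suc i)) (λ j → f (suc j)) (λ i i<k → g≗f (suc i) (s≤s i<k)) rest)

MinimalRepSystem⇒ClassCount : ∀ {m} (G : Graph m) (reps : List (Labeling m)) n → length reps ≡ n →
  MinimalRepSystem G reps → ClassCount G n
MinimalRepSystem⇒ClassCount G reps n len≡n (injective , covering , _) =
  (λ a → List.lookup reps (cast (sym len≡n) a)) , injective′ , covering′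
  where
  injective′ : ∀ a b → Equiv G (List.lookup reps (cast (sym len≡n) a)) (List.lookup reps (cast (sym len≡n) b)) → a ≡ b
  injective′ a b eq = toℕ-injective (trans (sym (toℕ-cast (sym len≡n) a))
    (trans (cong toℕ (injective _ _ eq)) (toℕ-cast (sym len≡n) b)))
  covering′ : ∀ d → Σ (Fin n) λ a → Equiv G d (List.lookup reps (cast (sym len≡n) a))
  covering′ d with covering d
  ... | b , eq = cast len≡n b , subst (λ z → Equiv G d (List.lookup reps z)) (sym (cast-involutive (sym len≡n) len≡n b)) eq

minimalRepSystem-byIndex : ∀ {m} (G : Graph m) (reps : List (Labeling m)) (rep : ℕ → Labeling m) (index : Labeling m → ℕ) →
  Enumerates reps rep → (∀ {d d′} → Equiv G d d′ → index d ≡ index d′) →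
  (∀ j → j < length reps → index (rep j) ≡ j) →
  (∀ d → Σ ℕ λ j → j < length reps × Equiv G d (rep j)) →
  (∀ j → j < length reps → ∀ d → Equiv G d (rep j) → weight (rep j) ≤ weight d) →
  MinimalRepSystem G reps
minimalRepSystem-byIndex G reps rep index enum invariant index-rep covering minimal = injective , covering′ , minimal′
  where
  injective : ∀ a b → Equiv G (List.lookup reps a) (List.lookup reps b) → a ≡ b
  injective a b eq = toℕ-injective (begin
    toℕ a                        ≡⟨ sym (index-rep (toℕ a) (toℕ<n a)) ⟩
    index (rep (toℕ a))          ≡⟨ cong index (sym (enum a)) ⟩
    index (List.lookup reps a)   ≡⟨ invariant eq ⟩
    index (List.lookup reps b)   ≡⟨ cong index (enum b) ⟩
    index (rep (toℕ b))          ≡⟨ index-rep (toℕ b) (toℕ<n b) ⟩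
    toℕ b                        ∎)
    where open ≡-Reasoning
  covering′ : ∀ d → Σ (Fin (length reps)) λ a → Equiv G d (List.lookup reps a)
  covering′ d with covering d
  ... | j , j<len , eq = fromℕ< j<len , subst (Equiv G d) (sym (trans (enum _) (cong rep (toℕ-fromℕ< j<len)))) eq
  minimal′ : ∀ a d → Equiv G d (List.lookup reps a) → weight (List.lookup reps a) ≤ weight d
  minimal′ a d eq = subst (λ r → weight r ≤ weight d) (sym (enum a)) (minimal (toℕ a) (toℕ<n a) d (subst (Equiv G d) (enum a) eq))

data Edge (n : ℕ) : ℕ → ℕ → Set where
  edge-1-2   : Edge n 1 2
  edge-0-2   : Edge n 0 2
  edge-path  : ∀ {a} → 2 ≤ a → suc a ≤ n ∸ 2 → Edge n a (suc a)
  edge-fork₁ : Edge n (n ∸ 2) (n ∸ 1)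
  edge-fork₂ : Edge n (n ∸ 2) n

Adjacent : ℕ → ℕ → ℕ → Set
Adjacent n a b = Edge n a b ⊎ Edge n b a

edgeℕ⇒Edge : ∀ n a b → T (edgeℕ n a b) → Edge n a b
edgeℕ⇒Edge n a b h with to T-∨ h
... | inj₁ h₁ = let a≡1 , b≡2 = to T-∧ h₁ in
  subst₂ (Edge n) (sym (≡ᵇ⇒≡ a 1 a≡1)) (sym (≡ᵇ⇒≡ b 2 b≡2)) edge-1-2
... | inj₂ h₂ with to T-∨ h₂
...   | inj₁ h₁ = let a≡0 , b≡2 = to T-∧ h₁ in
  subst₂ (Edge n) (sym (≡ᵇ⇒≡ a 0 a≡0)) (sym (≡ᵇ⇒≡ b 2 b≡2)) edge-0-2
...   | inj₂ h₃ with to T-∨ h₃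
...     | inj₁ h₁ = let 2≤a , h′ = to T-∧ h₁ ; b≡1+a , b≤n∸2 = to T-∧ h′ ; b≡1+a = ≡ᵇ⇒≡ b (suc a) b≡1+a in
  subst (Edge n a) (sym b≡1+a) (edge-path (≤ᵇ⇒≤ 2 a 2≤a) (subst (_≤ n ∸ 2) b≡1+a (≤ᵇ⇒≤ b (n ∸ 2) b≤n∸2)))
...     | inj₂ h₄ with to T-∨ h₄
...       | inj₁ h₁ = let a≡n∸2 , b≡n∸1 = to T-∧ h₁ in
  subst₂ (Edge n) (sym (≡ᵇ⇒≡ a (n ∸ 2) a≡n∸2)) (sym (≡ᵇ⇒≡ b (n ∸ 1) b≡n∸1)) edge-fork₁
...       | inj₂ h₅ = let a≡n∸2 , b≡n = to T-∧ h₅ in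
  subst₂ (Edge n) (sym (≡ᵇ⇒≡ a (n ∸ 2) a≡n∸2)) (sym (≡ᵇ⇒≡ b n b≡n)) edge-fork₂

Edge⇒edgeℕ : ∀ {n a b} → Edge n a b → T (edgeℕ n a b)
Edge⇒edgeℕ edge-1-2 = _
Edge⇒edgeℕ edge-0-2 = _
Edge⇒edgeℕ {n} {a} (edge-path 2≤a a+1≤n∸2) =
  ∨-introʳ ((a ≡ᵇ 1) ∧ (suc a ≡ᵇ 2)) _ (∨-introʳ ((a ≡ᵇ 0) ∧ (suc a ≡ᵇ 2)) _ (∨-introˡ _ _
    (from T-∧ (≤⇒≤ᵇ 2≤a , from T-∧ (≡⇒≡ᵇ (suc a) (suc a) refl , ≤⇒≤ᵇ a+1≤n∸2)))))
Edge⇒edgeℕ {n} edge-fork₁ =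
  ∨-introʳ ((n ∸ 2 ≡ᵇ 1) ∧ (n ∸ 1 ≡ᵇ 2)) _ (∨-introʳ ((n ∸ 2 ≡ᵇ 0) ∧ (n ∸ 1 ≡ᵇ 2)) _
    (∨-introʳ ((2 ≤ᵇ n ∸ 2) ∧ (n ∸ 1 ≡ᵇ suc (n ∸ 2)) ∧ (n ∸ 1 ≤ᵇ n ∸ 2)) _ (∨-introˡ _ _
      (from T-∧ (≡⇒≡ᵇ (n ∸ 2) _ refl , ≡⇒≡ᵇ (n ∸ 1) _ refl)))))
Edge⇒edgeℕ {n} edge-fork₂ =
  ∨-introʳ ((n ∸ 2 ≡ᵇ 1) ∧ (n ≡ᵇ 2)) _ (∨-introʳ ((n ∸ 2 ≡ᵇ 0) ∧ (n ≡ᵇ 2)) _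
    (∨-introʳ ((2 ≤ᵇ n ∸ 2) ∧ (n ≡ᵇ suc (n ∸ 2)) ∧ (n ≤ᵇ n ∸ 2)) _ (∨-introʳ ((n ∸ 2 ≡ᵇ n ∸ 2) ∧ (n ≡ᵇ n ∸ 1)) _
      (from T-∧ (≡⇒≡ᵇ (n ∸ 2) _ refl , ≡⇒≡ᵇ n _ refl)))))

adjacentℕ : ℕ → ℕ → ℕ → Bool
adjacentℕ n a b = edgeℕ n a b ∨ edgeℕ n b a

adjacentℕ⇒Adjacent : ∀ n a b → T (adjacentℕ n a b) → Adjacent n a b
adjacentℕ⇒Adjacent n a b h with to T-∨ h
... | inj₁ ab = inj₁ (edgeℕ⇒Edge n a b ab)
... | inj₂ ba = inj₂ (edgeℕ⇒Edge n b a ba)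

Adjacent⇒adjacentℕ : ∀ {n a b} → Adjacent n a b → T (adjacentℕ n a b)
Adjacent⇒adjacentℕ {n} {a} {b} (inj₁ ab) = ∨-introˡ _ (edgeℕ n b a) (Edge⇒edgeℕ ab)
Adjacent⇒adjacentℕ {n} {a} {b} (inj₂ ba) = ∨-introʳ (edgeℕ n a b) _ (Edge⇒edgeℕ ba)

-- Writing n as 5 + t makes n ∸ 1 and n ∸ 2 compute.
N : ℕ → ℕ
N t = 5 + t

neighbour-leaf : ∀ t {j x} → j ≤ 1 → Adjacent (N t) j x → x ≡ 2
neighbour-leaf t _         (inj₁ edge-1-2)                    = refl
neighbour-leaf t _         (inj₁ edge-0-2)                    = refl
neighbour-leaf t (s≤s ())  (inj₁ (edge-path (s≤s (s≤s _)) _))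
neighbour-leaf t (s≤s ())  (inj₁ edge-fork₁)
neighbour-leaf t (s≤s ())  (inj₁ edge-fork₂)
neighbour-leaf t (s≤s ())  (inj₂ edge-1-2)
neighbour-leaf t (s≤s ())  (inj₂ edge-0-2)
neighbour-leaf t (s≤s z≤n) (inj₂ (edge-path () _))
neighbour-leaf t (s≤s ())  (inj₂ edge-fork₁)
neighbour-leaf t (s≤s ())  (inj₂ edge-fork₂)

neighbour-2 : ∀ t {x} → Adjacent (N t) 2 x → x ≡ 1 ⊎ x ≡ 3 ⊎ x ≡ 0
neighbour-2 t (inj₁ (edge-path _ _))       = inj₂ (inj₁ refl)
neighbour-2 t (inj₂ edge-1-2)              = inj₁ refl
neighbour-2 t (inj₂ edge-0-2)              = inj₂ (inj₂ refl)
neighbour-2 t (inj₂ (edge-path (s≤s ()) _))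

neighbour-path : ∀ t {i x} → i < t → Adjacent (N t) (3 + i) x → x ≡ 2 + i ⊎ x ≡ 4 + i
neighbour-path t i<t (inj₁ (edge-path _ _)) = inj₂ refl
neighbour-path t i<t (inj₁ edge-fork₁)      = ⊥-elim (n≮n t i<t)
neighbour-path t i<t (inj₁ edge-fork₂)      = ⊥-elim (n≮n t i<t)
neighbour-path t i<t (inj₂ (edge-path _ _)) = inj₁ refl
neighbour-path t i<t (inj₂ edge-fork₁)      = ⊥-elim (m+n≮n 1 t i<t)
neighbour-path t i<t (inj₂ edge-fork₂)      = ⊥-elim (m+n≮n 2 t i<t)

neighbour-fork : ∀ t {x} → Adjacent (N t) (3 + t) x → x ≡ 2 + t ⊎ x ≡ 4 + t ⊎ x ≡ 5 + t
neighbour-fork t (inj₁ (edge-path _ 4+t≤3+t)) = ⊥-elim (n≮n (3 + t) 4+t≤3+t)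
neighbour-fork t (inj₁ edge-fork₁)            = inj₂ (inj₁ refl)
neighbour-fork t (inj₁ edge-fork₂)            = inj₂ (inj₂ refl)
neighbour-fork t (inj₂ (edge-path _ _))       = inj₁ refl

neighbour-n∸1 : ∀ t {x} → Adjacent (N t) (4 + t) x → x ≡ 3 + t
neighbour-n∸1 t (inj₁ (edge-path _ 5+t≤3+t)) = ⊥-elim (m+n≮n 1 (3 + t) 5+t≤3+t)
neighbour-n∸1 t (inj₂ (edge-path _ 4+t≤3+t)) = ⊥-elim (n≮n (3 + t) 4+t≤3+t)
neighbour-n∸1 t (inj₂ edge-fork₁)            = refl

neighbour-n : ∀ t {x} → Adjacent (N t) (5 + t) x → x ≡ 3 + t
neighbour-n t (inj₁ (edge-path _ 6+t≤3+t)) = ⊥-elim (m+n≮n 2 (3 + t) 6+t≤3+t)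
neighbour-n t (inj₂ (edge-path _ 5+t≤3+t)) = ⊥-elim (m+n≮n 1 (3 + t) 5+t≤3+t)
neighbour-n t (inj₂ edge-fork₂)            = refl

nbSum : ℕ → ℕ → (ℕ → Bool) → Bool
nbSum t j D = xorSum (suc (N t)) (λ x → adjacentℕ (N t) j x ∧ D x)

nbSum-leaf : ∀ t {j} D → j ≤ 1 → nbSum t j D ≡ D 2
nbSum-leaf t {j} D j≤1 =
  xorSum-support₁ (suc (N t)) (adjacentℕ (N t) j) D 2 (s≤s (s≤s (s≤s z≤n)))
    (λ x p → neighbour-leaf t j≤1 (adjacentℕ⇒Adjacent _ _ x p)) (member j≤1)
  where
  member : j ≤ 1 → T (adjacentℕ (N t) j 2)
  member z≤n       = Adjacent⇒adjacentℕ {N t} (inj₁ edge-0-2)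
  member (s≤s z≤n) = Adjacent⇒adjacentℕ {N t} (inj₁ edge-1-2)

nbSum-2 : ∀ t D → nbSum t 2 D ≡ D 1 xor D 3 xor D 0
nbSum-2 t D =
  xorSum-support₃ (suc (N t)) (adjacentℕ (N t) 2) D 1 3 0 (s≤s (s≤s z≤n)) (s≤s (s≤s (s≤s (s≤s z≤n)))) (s≤s z≤n)
    (λ ()) (λ ()) (λ ()) (λ x p → neighbour-2 t (adjacentℕ⇒Adjacent _ _ x p))
    (Adjacent⇒adjacentℕ {N t} (inj₂ edge-1-2))
    (Adjacent⇒adjacentℕ {N t} (inj₁ (edge-path ≤-refl (s≤s (s≤s (s≤s z≤n))))))
    (Adjacent⇒adjacentℕ {N t} (inj₂ edge-0-2))

nbSum-path : ∀ t {i} D → i < t → nbSum t (3 + i) D ≡ D (2 + i) xor D (4 + i)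
nbSum-path t {i} D i<t =
  xorSum-support₂ (suc (N t)) (adjacentℕ (N t) (3 + i)) D (2 + i) (4 + i)
    (≤-trans (+-monoʳ-≤ 3 (<⇒≤ i<t)) (m≤n+m (3 + t) 3)) (≤-trans (+-monoʳ-≤ 5 (<⇒≤ i<t)) (n≤1+n _))
    (m≢1+n+m (2 + i) {1}) (λ x p → neighbour-path t i<t (adjacentℕ⇒Adjacent _ _ x p))
    (Adjacent⇒adjacentℕ {N t} (inj₂ (edge-path (s≤s (s≤s z≤n)) (+-monoʳ-≤ 3 (<⇒≤ i<t)))))
    (Adjacent⇒adjacentℕ {N t} (inj₁ (edge-path (s≤s (s≤s z≤n)) (+-monoʳ-≤ 3 i<t))))

nbSum-fork : ∀ t D → nbSum t (3 + t) D ≡ D (2 + t) xor D (4 + t) xor D (5 + t)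
nbSum-fork t D =
  xorSum-support₃ (suc (N t)) (adjacentℕ (N t) (3 + t)) D (2 + t) (4 + t) (5 + t)
    (m≤n+m (3 + t) 3) (m≤n+m (5 + t) 1) ≤-refl
    (m≢1+n+m (2 + t) {1}) (m≢1+n+m (2 + t) {2}) (n≢1+n (4 + t))
    (λ x p → neighbour-fork t (adjacentℕ⇒Adjacent _ _ x p))
    (Adjacent⇒adjacentℕ {N t} (inj₂ (edge-path (s≤s (s≤s z≤n)) ≤-refl)))
    (Adjacent⇒adjacentℕ {N t} (inj₁ edge-fork₁))
    (Adjacent⇒adjacentℕ {N t} (inj₁ edge-fork₂))

nbSum-n∸1 : ∀ t D → nbSum t (4 + t) D ≡ D (3 + t)
nbSum-n∸1 t D =
  xorSum-support₁ (suc (N t)) (adjacentℕ (N t) (4 + t)) D (3 + t) (m≤n+m (4 + t) 2)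
    (λ x p → neighbour-n∸1 t (adjacentℕ⇒Adjacent _ _ x p)) (Adjacent⇒adjacentℕ {N t} (inj₂ edge-fork₁))

nbSum-n : ∀ t D → nbSum t (5 + t) D ≡ D (3 + t)
nbSum-n t D =
  xorSum-support₁ (suc (N t)) (adjacentℕ (N t) (5 + t)) D (3 + t) (m≤n+m (4 + t) 2)
    (λ x p → neighbour-n t (adjacentℕ⇒Adjacent _ _ x p)) (Adjacent⇒adjacentℕ {N t} (inj₂ edge-fork₂))

Lab : ℕ → Set
Lab t = Vec Bool (suc (N t))

Tree : (t : ℕ) → Graph (suc (N t))
Tree t = Dtilde (N t)

neighbourSum≡nbSum : ∀ t (d : Lab t) (i : Fin (suc (N t))) → neighbourSum (Tree t) d i ≡ nbSum t (toℕ i) (lookupℕ d)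
neighbourSum≡nbSum t d i =
  foldr-xor-tabulate (suc (N t)) _ (λ x → adjacentℕ (N t) (toℕ i) x ∧ lookupℕ d x) (λ k → cong (adjacentℕ (N t) (toℕ i) (toℕ k) ∧_) (lookup≡lookupℕ d k))

lookupℕ-move : ∀ t (d : Lab t) (i : Fin (suc (N t))) x →
  lookupℕ (move (Tree t) i d) x ≡ lookupℕ d x xor ((x ≡ᵇ toℕ i) ∧ nbSum t (toℕ i) (lookupℕ d))
lookupℕ-move t d i x
  rewrite lookupℕ-[]≔ d i (lookup d i xor neighbourSum (Tree t) d i) x | neighbourSum≡nbSum t d i | lookup≡lookupℕ d i
  with x ≡ᵇ toℕ i in x≡i
... | true rewrite ≡ᵇ⇒≡ x (toℕ i) (from T-≡ x≡i) = refl
... | false = sym (xor-identityʳ _)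

code : ℕ → (ℕ → Bool) → ℕ → Bool
code t D c = D c xor D (suc c) xor ((c ≡ᵇ 1) ∧ D 0) xor ((c ≡ᵇ 3 + t) ∧ D (N t))

codeOf : ∀ t → Lab t → ℕ → Bool
codeOf t d = code t (lookupℕ d)

codeδ : ℕ → ℕ → ℕ → Bool
codeδ t j = code t (λ x → x ≡ᵇ j)

code-cong : ∀ t (D D′ : ℕ → Bool) → (∀ x → x ≤ N t → D x ≡ D′ x) → ∀ c → c < N t → code t D c ≡ code t D′ c
code-cong t D D′ D≗D′ c c<n = cong₂ _xor_ (D≗D′ c (<⇒≤ c<n)) (cong₂ _xor_ (D≗D′ (suc c) c<n)
  (cong₂ _xor_ (cong ((c ≡ᵇ 1) ∧_) (D≗D′ 0 z≤n)) (cong ((c ≡ᵇ 3 + t) ∧_) (D≗D′ (N t) ≤-refl))))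

code-xor : ∀ t (P Q : ℕ → Bool) c → code t (λ x → P x xor Q x) c ≡ code t P c xor code t Q c
code-xor t P Q c = XorSolver.solve 10 (λ p₀ p₁ pa pb q₀ q₁ qa qb e₁ e₂ →
    (p₀ :+ q₀) :+ ((p₁ :+ q₁) :+ ((e₁ :* (pa :+ qa)) :+ (e₂ :* (pb :+ qb))))
    := (p₀ :+ (p₁ :+ ((e₁ :* pa) :+ (e₂ :* pb)))) :+ (q₀ :+ (q₁ :+ ((e₁ :* qa) :+ (e₂ :* qb))))) refl
  (P c) (P (suc c)) (P 0) (P (N t)) (Q c) (Q (suc c)) (Q 0) (Q (N t)) (c ≡ᵇ 1) (c ≡ᵇ 3 + t)

code-disjoint-∨ : ∀ t (P Q : ℕ → Bool) → (∀ x → P x ∧ Q x ≡ false) →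
  ∀ c → c < N t → code t (λ x → P x ∨ Q x) c ≡ code t P c xor code t Q c
code-disjoint-∨ t P Q disjoint c c<n =
  trans (code-cong t _ (λ x → P x xor Q x) (λ x _ → ∨≡xor (P x) (Q x) (disjoint x)) c c<n) (code-xor t P Q c)
  where
  ∨≡xor : ∀ a b → a ∧ b ≡ false → a ∨ b ≡ a xor b
  ∨≡xor false b     _ = refl
  ∨≡xor true  false _ = refl

code-ends-false : ∀ t (D : ℕ → Bool) c → D 0 ≡ false → D (N t) ≡ false → code t D c ≡ D c xor D (suc c)
code-ends-false t D c D₀ Dₙ rewrite D₀ | Dₙ | ∧-zeroʳ (c ≡ᵇ 1) | ∧-zeroʳ (c ≡ᵇ 3 + t) | xor-identityʳ (D (suc c)) = refl

code-toggle : ∀ t (D D′ : ℕ → Bool) j s → (∀ x → D′ x ≡ D x xor ((x ≡ᵇ j) ∧ s)) →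
  ∀ c → code t D′ c ≡ code t D c xor (s ∧ codeδ t j c)
code-toggle t D D′ j s h c rewrite h c | h (suc c) | h 0 | h (N t) =
  XorSolver.solve 11 (λ a b z w S i₁ i₂ i₃ i₄ e₁ e₂ →
     (a :+ (i₁ :* S)) :+ ((b :+ (i₂ :* S)) :+ ((e₁ :* (z :+ (i₃ :* S))) :+ (e₂ :* (w :+ (i₄ :* S)))))
     := (a :+ (b :+ ((e₁ :* z) :+ (e₂ :* w)))) :+ (S :* (i₁ :+ (i₂ :+ ((e₁ :* i₃) :+ (e₂ :* i₄))))))
    refl (D c) (D (suc c)) (D 0) (D (N t)) s (c ≡ᵇ j) (suc c ≡ᵇ j) (0 ≡ᵇ j) (N t ≡ᵇ j) (c ≡ᵇ 1) (c ≡ᵇ 3 + t)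

toggle≡swap : ∀ (f : ℕ → Bool) p c → f c xor ((f p xor f (suc p)) ∧ ((c ≡ᵇ p) xor (c ≡ᵇ suc p))) ≡ f (swap p c)
toggle≡swap f p c with c ≟ p
... | yes refl rewrite ≡ᵇ-refl c | ≡ᵇ-false c (suc c) (n≢1+n c) with f c | f (suc c)
...   | false | false = refl
...   | false | true  = refl
...   | true  | false = refl
...   | true  | true  = refl
toggle≡swap f p c | no c≢p with c ≟ suc p
...   | yes refl rewrite ≡ᵇ-false c p c≢p | ≡ᵇ-refl c with f p | f (suc p)
...     | false | false = refl
...     | false | true  = refl
...     | true  | false = refl
...     | true  | true  = refl
toggle≡swap f p c | no c≢p | no c≢p+1
  rewrite ≡ᵇ-false c p c≢p | ≡ᵇ-false c (suc p) c≢p+1 | ∧-zeroʳ (f p xor f (suc p)) =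
  xor-identityʳ (f c)

codeδ-0 : ∀ t c → codeδ t 0 c ≡ (c ≡ᵇ 0) xor (c ≡ᵇ 1)
codeδ-0 t c rewrite ∧-identityʳ (c ≡ᵇ 1) | ∧-zeroʳ (c ≡ᵇ 3 + t) | xor-identityʳ (c ≡ᵇ 1) = refl

codeδ-path : ∀ t j c → j ≤ 2 + t → codeδ t (suc j) c ≡ (c ≡ᵇ j) xor (c ≡ᵇ suc j)
codeδ-path t j c j≤2+t
  rewrite ∧-zeroʳ (c ≡ᵇ 1) | ≡ᵇ-false (N t) (suc j) (λ e → m+n≮n 1 (3 + t) (≤-trans (≤-reflexive e) (s≤s j≤2+t)))
        | ∧-zeroʳ (c ≡ᵇ 3 + t) | xor-identityʳ (c ≡ᵇ j) = xor-comm (c ≡ᵇ suc j) (c ≡ᵇ j)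

codeδ-n∸1 : ∀ t c → codeδ t (4 + t) c ≡ (c ≡ᵇ 3 + t) xor (c ≡ᵇ 4 + t)
codeδ-n∸1 t c rewrite ∧-zeroʳ (c ≡ᵇ 1) | ≡ᵇ-false (suc t) t (≢-sym (n≢1+n t))
  | ∧-zeroʳ (c ≡ᵇ 3 + t) | xor-identityʳ (c ≡ᵇ 3 + t) = xor-comm (c ≡ᵇ 4 + t) (c ≡ᵇ 3 + t)

codeδ-n : ∀ t c → c < N t → codeδ t (N t) c ≡ (c ≡ᵇ 3 + t) xor (c ≡ᵇ 4 + t)
codeδ-n t c c<n rewrite ∧-zeroʳ (c ≡ᵇ 1) | ≡ᵇ-refl t | ≡ᵇ-false c (N t) (<⇒≢ c<n)
  | ∧-identityʳ (c ≡ᵇ 3 + t) = xor-comm (c ≡ᵇ 4 + t) (c ≡ᵇ 3 + t)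

nbSum-leaf-code : ∀ t {j} D → j ≤ 1 → nbSum t j D ≡ code t D 0 xor code t D 1
nbSum-leaf-code t D j≤1 rewrite nbSum-leaf t D j≤1 =
  XorSolver.solve 3 (λ a b c → c := (a :+ (b :+ con false)) :+ (b :+ (c :+ (a :+ con false)))) refl (D 0) (D 1) (D 2)

nbSum-2-code : ∀ t D → nbSum t 2 D ≡ code t D 1 xor code t D 2
nbSum-2-code t D rewrite nbSum-2 t D =
  XorSolver.solve 4 (λ a b c e → b :+ (e :+ a) := (b :+ (c :+ (a :+ con false))) :+ (c :+ (e :+ con false)))
    refl (D 0) (D 1) (D 2) (D 3)

nbSum-path-code : ∀ t {i} D → i < t → nbSum t (3 + i) D ≡ code t D (2 + i) xor code t D (3 + i)
nbSum-path-code t {i} D i<t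
  rewrite nbSum-path t D i<t | ≡ᵇ-false (2 + i) (3 + t) (λ e → <⇒≢ (s≤s (s≤s (≤-trans i<t (n≤1+n t)))) e)
        | ≡ᵇ-false (3 + i) (3 + t) (λ e → <⇒≢ (s≤s (s≤s (s≤s i<t))) e) =
  XorSolver.solve 3 (λ a b c → a :+ c := (a :+ (b :+ (con false :+ con false))) :+ (b :+ (c :+ (con false :+ con false))))
    refl (D (2 + i)) (D (3 + i)) (D (4 + i))

nbSum-fork-code : ∀ t D → nbSum t (3 + t) D ≡ code t D (2 + t) xor code t D (3 + t)
nbSum-fork-code t D rewrite nbSum-fork t D | ≡ᵇ-false t (suc t) (n≢1+n t) | ≡ᵇ-refl t =
  XorSolver.solve 4 (λ a b c e → a :+ (c :+ e) := (a :+ (b :+ (con false :+ con false))) :+ (b :+ (c :+ (con false :+ e))))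
    refl (D (2 + t)) (D (3 + t)) (D (4 + t)) (D (5 + t))

code-fork-pair : ∀ t D → code t D (3 + t) xor code t D (4 + t) ≡ D (3 + t)
code-fork-pair t D rewrite ≡ᵇ-false (suc t) t (≢-sym (n≢1+n t)) | ≡ᵇ-refl t =
  XorSolver.solve 3 (λ a b c → (a :+ (b :+ (con false :+ c))) :+ (b :+ (c :+ (con false :+ con false))) := a)
    refl (D (3 + t)) (D (4 + t)) (D (5 + t))

record MoveShape (t j : ℕ) (D : ℕ → Bool) : Set where
  field
    pos     : ℕ
    pos+1<n : suc pos < N t
    nbSum≡  : nbSum t j D ≡ code t D pos xor code t D (suc pos)
    codeδ≡  : ∀ c → c < N t → codeδ t j c ≡ (c ≡ᵇ pos) xor (c ≡ᵇ suc pos)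

moveShape : ∀ t j D → j ≤ N t → MoveShape t j D
moveShape t 0 D _ = record
  { pos = 0 ; pos+1<n = s≤s (s≤s z≤n) ; nbSum≡ = nbSum-leaf-code t D z≤n ; codeδ≡ = λ c _ → codeδ-0 t c }
moveShape t 1 D _ = record
  { pos = 0 ; pos+1<n = s≤s (s≤s z≤n) ; nbSum≡ = nbSum-leaf-code t D (s≤s z≤n) ; codeδ≡ = λ c _ → codeδ-path t 0 c z≤n }
moveShape t 2 D _ = record
  { pos = 1 ; pos+1<n = s≤s (s≤s (s≤s z≤n)) ; nbSum≡ = nbSum-2-code t D ; codeδ≡ = λ c _ → codeδ-path t 1 c (s≤s z≤n) }
moveShape t (suc (suc (suc i))) D (s≤s (s≤s (s≤s i≤2+t))) with <-cmp i t
... | tri< i<t _ _ = record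
  { pos = 2 + i ; pos+1<n = +-monoʳ-≤ 4 (≤-trans (<⇒≤ i<t) (n≤1+n t)) ; nbSum≡ = nbSum-path-code t D i<t
  ; codeδ≡ = λ c _ → codeδ-path t (2 + i) c (+-monoʳ-≤ 2 (<⇒≤ i<t)) }
... | tri≈ _ refl _ = record
  { pos = 2 + t ; pos+1<n = n≤1+n _ ; nbSum≡ = nbSum-fork-code t D ; codeδ≡ = λ c _ → codeδ-path t (2 + t) c ≤-refl }
... | tri> _ _ t<i with m≤n⇒m<n∨m≡n i≤2+t
...   | inj₁ i<2+t rewrite ≤-antisym (≤-pred i<2+t) t<i = record
  { pos = 3 + t ; pos+1<n = ≤-refl ; nbSum≡ = trans (nbSum-n∸1 t D) (sym (code-fork-pair t D))
  ; codeδ≡ = λ c _ → codeδ-n∸1 t c }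
...   | inj₂ refl = record
  { pos = 3 + t ; pos+1<n = ≤-refl ; nbSum≡ = trans (nbSum-n t D) (sym (code-fork-pair t D))
  ; codeδ≡ = codeδ-n t }

pair-unique : ∀ m p q → suc p < m → suc q < m →
  (∀ c → c < m → (c ≡ᵇ p) xor (c ≡ᵇ suc p) ≡ (c ≡ᵇ q) xor (c ≡ᵇ suc q)) → p ≡ q
pair-unique m p q p+1<m q+1<m h with p ≟ q
... | yes p≡q = p≡q
... | no p≢q = ⊥-elim (true≢false (trans (sym at-q) (trans (sym (h q (≤-trans (n≤1+n _) q+1<m))) at-q′)))
  where
  p≡q+1 : p ≡ suc q
  p≡q+1 = ≡ᵇ⇒≡ p (suc q) (from T-≡ (trans (sym (cong (_xor (p ≡ᵇ suc q)) (≡ᵇ-false p q p≢q)))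
            (trans (sym (h p (≤-trans (n≤1+n _) p+1<m))) (cong₂ _xor_ (≡ᵇ-refl p) (≡ᵇ-false p (suc p) (n≢1+n p))))))
  at-q : (q ≡ᵇ q) xor (q ≡ᵇ suc q) ≡ true
  at-q = cong₂ _xor_ (≡ᵇ-refl q) (≡ᵇ-false q (suc q) (n≢1+n q))
  at-q′ : (q ≡ᵇ p) xor (q ≡ᵇ suc p) ≡ false
  at-q′ = cong₂ _xor_ (≡ᵇ-false q p (λ q≡p → n≢1+n q (trans q≡p p≡q+1)))
                      (≡ᵇ-false q (suc p) (λ q≡p+1 → m≢1+n+m q {1} (trans q≡p+1 (cong suc p≡q+1))))

move-code : ∀ t (d : Lab t) (i : Fin (suc (N t))) p → suc p < N t →
  (∀ c → c < N t → codeδ t (toℕ i) c ≡ (c ≡ᵇ p) xor (c ≡ᵇ suc p)) →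
  (∀ c → c < N t → codeOf t (move (Tree t) i d) c ≡ codeOf t d (swap p c)) ×
  (∀ x → lookupℕ (move (Tree t) i d) x ≡ lookupℕ d x xor ((x ≡ᵇ toℕ i) ∧ (codeOf t d p xor codeOf t d (suc p))))
move-code t d i p p+1<n codeδ-i = moved-code , moved-values
  where
  open MoveShape (moveShape t (toℕ i) (lookupℕ d) (≤-pred (toℕ<n i)))
  nbSum-i : nbSum t (toℕ i) (lookupℕ d) ≡ codeOf t d p xor codeOf t d (suc p)
  nbSum-i = trans nbSum≡ (cong (λ z → codeOf t d z xor codeOf t d (suc z))
              (pair-unique (N t) pos p pos+1<n p+1<n (λ c c<n → trans (sym (codeδ≡ c c<n)) (codeδ-i c c<n))))
  moved-code : ∀ c → c < N t → codeOf t (move (Tree t) i d) c ≡ codeOf t d (swap p c)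
  moved-code c c<n = trans (code-toggle t (lookupℕ d) _ (toℕ i) _ (lookupℕ-move t d i) c)
    (trans (cong₂ (λ a b → codeOf t d c xor (a ∧ b)) nbSum-i (codeδ-i c c<n)) (toggle≡swap (codeOf t d) p c))
  moved-values : ∀ x → lookupℕ (move (Tree t) i d) x ≡ lookupℕ d x xor ((x ≡ᵇ toℕ i) ∧ (codeOf t d p xor codeOf t d (suc p)))
  moved-values x = trans (lookupℕ-move t d i x) (cong (λ z → lookupℕ d x xor ((x ≡ᵇ toℕ i) ∧ z)) nbSum-i)

record Reach (t : ℕ) (d : Lab t) (V : ℕ → Bool) (a b : Bool) : Set where
  constructor reach
  field
    target : Lab t
    equiv  : Equiv (Tree t) d target
    code≡  : ∀ c → c < N t → codeOf t target c ≡ V c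
    end₀≡  : lookupℕ target 0 ≡ a
    endₙ≡  : lookupℕ target (N t) ≡ b

reach-move : ∀ t (d : Lab t) j → j < suc (N t) → ∀ p → suc p < N t →
  (∀ c → c < N t → codeδ t j c ≡ (c ≡ᵇ p) xor (c ≡ᵇ suc p)) →
  Reach t d (λ c → codeOf t d (swap p c))
    (lookupℕ d 0 xor ((0 ≡ᵇ j) ∧ (codeOf t d p xor codeOf t d (suc p))))
    (lookupℕ d (N t) xor ((N t ≡ᵇ j) ∧ (codeOf t d p xor codeOf t d (suc p))))
reach-move t d j j<n+1 p p+1<n codeδ-j =
  reach (move (Tree t) i d) (fwd (i , refl) ◅ ε) (proj₁ moved)
    (trans (proj₂ moved 0) (cong (λ z → lookupℕ d 0 xor ((0 ≡ᵇ z) ∧ _)) toℕ-i))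
    (trans (proj₂ moved (N t)) (cong (λ z → lookupℕ d (N t) xor ((N t ≡ᵇ z) ∧ _)) toℕ-i))
  where
  i = fromℕ< j<n+1
  toℕ-i : toℕ i ≡ j
  toℕ-i = toℕ-fromℕ< j<n+1
  moved = move-code t d i p p+1<n (λ c c<n → trans (cong (λ z → codeδ t z c) toℕ-i) (codeδ-j c c<n))

reach-swap : ∀ t (d : Lab t) p → suc p < N t → Reach t d (λ c → codeOf t d (swap p c)) (lookupℕ d 0) (lookupℕ d (N t))
reach-swap t d zero p+1<n with reach-move t d 1 (s≤s (s≤s z≤n)) 0 p+1<n (λ c _ → codeδ-path t 0 c z≤n)
... | reach d′ eq code≡ end₀ endₙ = reach d′ eq code≡ (trans end₀ (xor-identityʳ _)) (trans endₙ (xor-identityʳ _))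
reach-swap t d (suc p) p+2<n with p ≤? suc t
... | yes p≤1+t with reach-move t d (2 + p) (s≤s (≤-trans (s≤s (s≤s p≤1+t)) (m≤n+m (3 + t) 2))) (suc p) p+2<n
                       (λ c _ → codeδ-path t (suc p) c (s≤s p≤1+t))
...   | reach d′ eq code≡ end₀ endₙ = reach d′ eq code≡ (trans end₀ (xor-identityʳ _))
        (trans endₙ (xor-false∧ _ _ _ (≡ᵇ-false (N t) (2 + p) (λ e → m+n≮n 1 (3 + t) (≤-trans (≤-reflexive e) (s≤s (s≤s p≤1+t)))))))
reach-swap t d (suc p) p+2<n | no p≰1+t with ≤-antisym (≤-pred (≤-pred (≤-pred p+2<n))) (≰⇒> p≰1+t)
... | refl with reach-move t d (4 + t) (s≤s (n≤1+n _)) (3 + t) p+2<n (λ c _ → codeδ-n∸1 t c)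
...   | reach d′ eq code≡ end₀ endₙ = reach d′ eq code≡ (trans end₀ (xor-identityʳ _))
        (trans endₙ (xor-false∧ _ _ _ (≡ᵇ-false (suc t) t (≢-sym (n≢1+n t)))))

reach-toggle₀ : ∀ t (d : Lab t) → codeOf t d 0 xor codeOf t d 1 ≡ true →
  Reach t d (codeOf t d) (not (lookupℕ d 0)) (lookupℕ d (N t))
reach-toggle₀ t d differ with reach-move t d 0 (s≤s z≤n) 0 (s≤s (s≤s z≤n)) (λ c _ → codeδ-0 t c)
... | reach d₁ eq₁ code₁ end₀₁ endₙ₁ with reach-swap t d₁ 0 (s≤s (s≤s z≤n))
... | reach d₂ eq₂ code₂ end₀₂ endₙ₂ = reach d₂ (eq₁ ◅◅ eq₂)
  (λ c c<n → trans (code₂ c c<n) (trans (code₁ (swap 0 c) (swap-< (N t) 0 c (s≤s (s≤s z≤n)) c<n)) (cong (codeOf t d) (swap-involutive 0 c))))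
  (trans end₀₂ (trans end₀₁ (xor-true∧ (lookupℕ d 0) true _ refl differ)))
  (trans endₙ₂ (trans endₙ₁ (xor-false∧ (lookupℕ d (N t)) false (codeOf t d 0 xor codeOf t d 1) refl)))

reach-toggleₙ : ∀ t (d : Lab t) → codeOf t d (3 + t) xor codeOf t d (4 + t) ≡ true →
  Reach t d (codeOf t d) (lookupℕ d 0) (not (lookupℕ d (N t)))
reach-toggleₙ t d differ with reach-move t d (N t) ≤-refl (3 + t) ≤-refl (codeδ-n t)
... | reach d₁ eq₁ code₁ end₀₁ endₙ₁ with reach-swap t d₁ (3 + t) ≤-refl
... | reach d₂ eq₂ code₂ end₀₂ endₙ₂ = reach d₂ (eq₁ ◅◅ eq₂)
  (λ c c<n → trans (code₂ c c<n) (trans (code₁ (swap (3 + t) c) (swap-< (N t) (3 + t) c ≤-refl c<n)) (cong (codeOf t d) (swap-involutive (3 + t) c))))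
  (trans end₀₂ (trans end₀₁ (xor-false∧ (lookupℕ d 0) false (codeOf t d (3 + t) xor codeOf t d (4 + t)) refl)))
  (trans endₙ₂ (trans endₙ₁ (xor-true∧ (lookupℕ d (N t)) (t ≡ᵇ t) _ (≡ᵇ-refl t) differ)))

codeWeight : ∀ t → Lab t → ℕ
codeWeight t d = count (N t) (codeOf t d)

move-swaps-code : ∀ t (d : Lab t) (i : Fin (suc (N t))) → Σ ℕ λ p → suc p < N t ×
  (∀ c → c < N t → codeOf t (move (Tree t) i d) c ≡ codeOf t d (swap p c)) ×
  (∀ x → lookupℕ (move (Tree t) i d) x ≡ lookupℕ d x xor ((x ≡ᵇ toℕ i) ∧ (codeOf t d p xor codeOf t d (suc p))))
move-swaps-code t d i = pos , pos+1<n , move-code t d i pos pos+1<n codeδ≡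
  where open MoveShape (moveShape t (toℕ i) (lookupℕ d) (≤-pred (toℕ<n i)))

codeWeight-move : ∀ t i (d : Lab t) → codeWeight t (move (Tree t) i d) ≡ codeWeight t d
codeWeight-move t i d with move-swaps-code t d i
... | p , p+1<n , moved-code , _ = trans (count-cong (N t) moved-code) (count-swap (N t) p (codeOf t d) p+1<n)

codeWeight-invariant : ∀ t {d d′} → Equiv (Tree t) d d′ → codeWeight t d ≡ codeWeight t d′
codeWeight-invariant t = Equiv-invariant (Tree t) (codeWeight t) (codeWeight-move t)

ConstantCode : ∀ t → Lab t → Set
ConstantCode t d = (∀ c → c < N t → codeOf t d c ≡ false) ⊎ (∀ c → c < N t → codeOf t d c ≡ true)

Extreme : ∀ t → Lab t → Set
Extreme t d = codeWeight t d ≡ 0 ⊎ codeWeight t d ≡ N t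

Extreme⇒ConstantCode : ∀ t (d : Lab t) → Extreme t d → ConstantCode t d
Extreme⇒ConstantCode t d (inj₁ w≡0) = inj₁ (count≡0⇒false (N t) (codeOf t d) w≡0)
Extreme⇒ConstantCode t d (inj₂ w≡n) = inj₂ (count≡m⇒true (N t) (codeOf t d) w≡n)

Extreme-move : ∀ t i (d : Lab t) → Extreme t d → Extreme t (move (Tree t) i d)
Extreme-move t i d = subst (λ w → w ≡ 0 ⊎ w ≡ N t) (sym (codeWeight-move t i d))

Extreme-unmove : ∀ {t i} {d : Lab t} → Extreme t (move (Tree t) i d) → Extreme t d
Extreme-unmove {t} {i} {d} = subst (λ w → w ≡ 0 ⊎ w ≡ N t) (codeWeight-move t i d)

ends-move : ∀ t i (d : Lab t) → ConstantCode t d →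
  lookupℕ (move (Tree t) i d) 0 ≡ lookupℕ d 0 × lookupℕ (move (Tree t) i d) (N t) ≡ lookupℕ d (N t)
ends-move t i d constant with move-swaps-code t d i
... | p , p+1<n , _ , moved-values =
  trans (moved-values 0) (unchanged _ _) , trans (moved-values (N t)) (unchanged _ _)
  where
  pair-equal : ConstantCode t d → codeOf t d p xor codeOf t d (suc p) ≡ false
  pair-equal (inj₁ all-false) rewrite all-false p (≤-trans (n≤1+n _) p+1<n) | all-false (suc p) p+1<n = refl
  pair-equal (inj₂ all-true)  rewrite all-true p (≤-trans (n≤1+n _) p+1<n) | all-true (suc p) p+1<n = refl
  unchanged : ∀ a b → a xor (b ∧ (codeOf t d p xor codeOf t d (suc p))) ≡ a
  unchanged a b rewrite pair-equal constant | ∧-zeroʳ b = xor-identityʳ a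

ends-invariant : ∀ t {d d′} → Equiv (Tree t) d d′ → Extreme t d →
  lookupℕ d 0 ≡ lookupℕ d′ 0 × lookupℕ d (N t) ≡ lookupℕ d′ (N t)
ends-invariant t ε _ = refl , refl
ends-invariant t {d} (fwd (i , refl) ◅ steps) extreme
  with ends-move t i d (Extreme⇒ConstantCode t d extreme) | ends-invariant t steps (Extreme-move t i d extreme)
... | e₀ , eₙ | e₀′ , eₙ′ = trans (sym e₀) e₀′ , trans (sym eₙ) eₙ′
ends-invariant t (_◅_ {j = d₁} (bwd (i , refl)) steps) extreme
  with ends-move t i d₁ (Extreme⇒ConstantCode t d₁ (Extreme-unmove {i = i} {d₁} extreme))
     | ends-invariant t steps (Extreme-unmove {i = i} {d₁} extreme)
... | e₀ , eₙ | e₀′ , eₙ′ = trans e₀ e₀′ , trans eₙ eₙ′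

_⟫_ : ∀ {t d V V′ a b} → Reach t d V a b →
  (∀ d′ → (∀ c → c < N t → codeOf t d′ c ≡ V c) → Reach t d′ V′ (lookupℕ d′ 0) (lookupℕ d′ (N t))) → Reach t d V′ a b
reach d₁ eq₁ code₁ end₀₁ endₙ₁ ⟫ next with next d₁ code₁
... | reach d₂ eq₂ code₂ end₀₂ endₙ₂ = reach d₂ (eq₁ ◅◅ eq₂) code₂ (trans end₀₂ end₀₁) (trans endₙ₂ endₙ₁)

reach-code-cong : ∀ {t d V V′ a b} → (∀ c → c < N t → V c ≡ V′ c) → Reach t d V a b → Reach t d V′ a b
reach-code-cong V≡V′ (reach d′ eq code≡ end₀ endₙ) = reach d′ eq (λ c c<n → trans (code≡ c c<n) (V≡V′ c c<n)) end₀ endₙ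

-- Bubble sort of the code, by induction on a bound for positionSum.
reach-sorted-below : ∀ t bound (d : Lab t) → positionSum (N t) (codeOf t d) ≤ bound →
  Reach t d (λ c → c <ᵇ codeWeight t d) (lookupℕ d 0) (lookupℕ d (N t))
reach-sorted-below t bound d below with ascent-or-Sorted (N t) (codeOf t d)
... | inj₂ sorted = reach d ε (Sorted⇒prefix (N t) (codeOf t d) sorted) refl refl
... | inj₁ (p , p+1<n , cp , cp+1) = reach-swap t d p p+1<n ⟫ λ d₁ code₁ →
  let decreased = ≤-trans (s≤s (≤-reflexive (sumTo-cong (N t) (λ c c<n → cong (λ z → if z then c else 0) (code₁ c c<n)))))
                    (positionSum-swap (N t) p (codeOf t d) p+1<n cp cp+1)
  in reach-code-cong (λ c _ → cong (c <ᵇ_) (trans (count-cong (N t) code₁) (count-swap (N t) p (codeOf t d) p+1<n)))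
       (continue d₁ bound (≤-trans decreased below))
  where
  continue : ∀ d₁ bound → positionSum (N t) (codeOf t d₁) < bound →
    Reach t d₁ (λ c → c <ᵇ codeWeight t d₁) (lookupℕ d₁ 0) (lookupℕ d₁ (N t))
  continue d₁ (suc bound) smaller = reach-sorted-below t bound d₁ (≤-pred smaller)

reach-sorted : ∀ t (d : Lab t) → Reach t d (λ c → c <ᵇ codeWeight t d) (lookupℕ d 0) (lookupℕ d (N t))
reach-sorted t d = reach-sorted-below t _ d ≤-refl

reach-moveHole : ∀ t (d : Lab t) w m → m ≤ w → w < N t → (∀ c → c < N t → codeOf t d c ≡ holed w m c) →
  Reach t d (holed w 0) (lookupℕ d 0) (lookupℕ d (N t))
reach-moveHole t d w zero    _   _   holed-at-m = reach d ε holed-at-m refl refl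
reach-moveHole t d w (suc m) m<w w<n holed-at-m = reach-swap t d m m+1<n ⟫ λ d₁ code₁ →
  reach-moveHole t d₁ w m (≤-trans (n≤1+n m) m<w) w<n
    (λ c c<n → trans (code₁ c c<n) (trans (holed-at-m (swap m c) (swap-< (N t) m c m+1<n c<n)) (holed-swap w m c m<w)))
  where m+1<n = ≤-trans (s≤s m<w) w<n

reach-moveOne : ∀ t (d : Lab t) a m k → a ≤ m → m + k < N t → (∀ c → c < N t → codeOf t d c ≡ prefixPlus a m c) →
  Reach t d (prefixPlus a (m + k)) (lookupℕ d 0) (lookupℕ d (N t))
reach-moveOne t d a m zero a≤m _ one-at-m =
  reach-code-cong (λ c _ → cong (λ z → prefixPlus a z c) (sym (+-identityʳ m))) (reach d ε one-at-m refl refl)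
reach-moveOne t d a m (suc k) a≤m m+k+1<n one-at-m = reach-swap t d m m+1<n ⟫ λ d₁ code₁ →
  reach-code-cong (λ c _ → cong (λ z → prefixPlus a z c) (sym (+-suc m k)))
    (reach-moveOne t d₁ a (suc m) k (≤-trans a≤m (n≤1+n m)) 1+m+k<n
      (λ c c<n → trans (code₁ c c<n) (trans (one-at-m (swap m c) (swap-< (N t) m c m+1<n c<n)) (prefixPlus-swap a m c a≤m))))
  where
  1+m+k<n = subst (_< N t) (+-suc m k) m+k+1<n
  m+1<n = ≤-trans (s≤s (s≤s (m≤m+n m k))) 1+m+k<n

-- If d_n = 1, carry the last one of the sorted code to position n ∸ 2, flip d_n by the move at n, and sort again.
reach-clearEnd : ∀ t (d : Lab t) a → codeWeight t d ≡ suc a → a ≤ 3 + t →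
  Reach t d (λ c → c <ᵇ suc a) (lookupℕ d 0) false
reach-clearEnd t d a w≡1+a a≤3+t with reach-sorted t d
... | reach d₁ eq₁ code₁ end₀₁ endₙ₁ = clear (lookupℕ d₁ (N t)) refl
  where
  prefix₁ : ∀ c → c < N t → codeOf t d₁ c ≡ (c <ᵇ suc a)
  prefix₁ c c<n = trans (code₁ c c<n) (cong (c <ᵇ_) w≡1+a)
  a+[3+t∸a]≡3+t : a + (3 + t ∸ a) ≡ 3 + t
  a+[3+t∸a]≡3+t = m+[n∸m]≡n a≤3+t
  clear : ∀ b → lookupℕ d₁ (N t) ≡ b → Reach t d (λ c → c <ᵇ suc a) (lookupℕ d 0) false
  clear false dₙ≡false = reach d₁ eq₁ prefix₁ end₀₁ dₙ≡false
  clear true  dₙ≡true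
    with reach-moveOne t d₁ a a (3 + t ∸ a) ≤-refl (subst (_< N t) (sym a+[3+t∸a]≡3+t) (n≤1+n _))
           (λ c c<n → trans (prefix₁ c c<n) (prefix≡prefixPlus a c))
  ... | reach d₂ eq₂ code₂ end₀₂ endₙ₂ with reach-toggleₙ t d₂ differ
    where
    differ : codeOf t d₂ (3 + t) xor codeOf t d₂ (4 + t) ≡ true
    differ rewrite code₂ (3 + t) (m≤n+m (4 + t) 1) | code₂ (4 + t) ≤-refl | a+[3+t∸a]≡3+t
                 | <ᵇ-false {3 + t} {a} a≤3+t | <ᵇ-false {4 + t} {a} (≤-trans a≤3+t (n≤1+n _))
                 | ≡ᵇ-refl t | ≡ᵇ-false (suc t) t (≢-sym (n≢1+n t)) = refl
  ... | reach d₃ eq₃ code₃ end₀₃ endₙ₃ with reach-sorted t d₃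
  ... | reach d₄ eq₄ code₄ end₀₄ endₙ₄ = reach d₄ (eq₁ ◅◅ eq₂ ◅◅ eq₃ ◅◅ eq₄)
    (λ c c<n → trans (code₄ c c<n) (cong (c <ᵇ_) (trans (sym (codeWeight-invariant t (eq₁ ◅◅ eq₂ ◅◅ eq₃))) w≡1+a)))
    (trans end₀₄ (trans end₀₃ (trans end₀₂ end₀₁)))
    (trans endₙ₄ (trans endₙ₃ (cong not (trans endₙ₂ dₙ≡true))))

-- Shift the block of ones one place to the right, so that letters 0 and 1 differ and the move at 0 can clear d_0.
reach-normalForm : ∀ t (d : Lab t) a → codeWeight t d ≡ suc a → a ≤ 3 + t →
  Reach t d (holed (suc a) 0) false false
reach-normalForm t d a w≡1+a a≤3+t with reach-clearEnd t d a w≡1+a a≤3+t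
... | reach d₁ eq₁ code₁ end₀₁ endₙ₁ with reach-moveHole t d₁ (suc a) (suc a) ≤-refl (s≤s (s≤s a≤3+t))
                                             (λ c c<n → trans (code₁ c c<n) (prefix≡holed (suc a) c))
... | reach d₂ eq₂ code₂ end₀₂ endₙ₂ = clear (lookupℕ d₂ 0) refl
  where
  clear : ∀ b → lookupℕ d₂ 0 ≡ b → Reach t d (holed (suc a) 0) false false
  clear false d₀≡false = reach d₂ (eq₁ ◅◅ eq₂) code₂ d₀≡false (trans endₙ₂ endₙ₁)
  clear true  d₀≡true with reach-toggle₀ t d₂ (cong₂ _xor_ (code₂ 0 (s≤s z≤n)) (code₂ 1 (s≤s (s≤s z≤n))))
  ... | reach d₃ eq₃ code₃ end₀₃ endₙ₃ = reach d₃ (eq₁ ◅◅ eq₂ ◅◅ eq₃) (λ c c<n → trans (code₃ c c<n) (code₂ c c<n))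
    (trans end₀₃ (cong not d₀≡true)) (trans endₙ₃ (trans endₙ₂ endₙ₁))

code-values-injective : ∀ t (D D′ : ℕ → Bool) → (∀ c → c < N t → code t D c ≡ code t D′ c) →
  D 0 ≡ D′ 0 → D (N t) ≡ D′ (N t) → ∀ x → x < N t → D x ≡ D′ x
code-values-injective t D D′ same-code same₀ sameₙ zero    _     = same₀
code-values-injective t D D′ same-code same₀ sameₙ (suc y) 1+y<n = begin
  D (suc y)
    ≡⟨ next D ⟩
  code t D y xor (D y xor (((y ≡ᵇ 1) ∧ D 0) xor ((y ≡ᵇ 3 + t) ∧ D (N t))))
    ≡⟨ cong₂ (λ a b → code t D y xor (a xor (((y ≡ᵇ 1) ∧ b) xor ((y ≡ᵇ 3 + t) ∧ D (N t))))) same-y same₀ ⟩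
  code t D y xor (D′ y xor (((y ≡ᵇ 1) ∧ D′ 0) xor ((y ≡ᵇ 3 + t) ∧ D (N t))))
    ≡⟨ cong₂ (λ a b → a xor (D′ y xor (((y ≡ᵇ 1) ∧ D′ 0) xor ((y ≡ᵇ 3 + t) ∧ b)))) (same-code y y<n) sameₙ ⟩
  code t D′ y xor (D′ y xor (((y ≡ᵇ 1) ∧ D′ 0) xor ((y ≡ᵇ 3 + t) ∧ D′ (N t))))
    ≡⟨ sym (next D′) ⟩
  D′ (suc y) ∎
  where
  open ≡-Reasoning
  y<n = ≤-trans (n≤1+n _) 1+y<n
  same-y = code-values-injective t D D′ same-code same₀ sameₙ y y<n
  next : ∀ (E : ℕ → Bool) → E (suc y) ≡ code t E y xor (E y xor (((y ≡ᵇ 1) ∧ E 0) xor ((y ≡ᵇ 3 + t) ∧ E (N t))))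
  next E = XorSolver.solve 6 (λ a b e₁ z e₂ w → b := (a :+ (b :+ ((e₁ :* z) :+ (e₂ :* w)))) :+ (a :+ ((e₁ :* z) :+ (e₂ :* w))))
    refl (E y) (E (suc y)) (y ≡ᵇ 1) (E 0) (y ≡ᵇ 3 + t) (E (N t))

code-injective : ∀ t (d d′ : Lab t) → (∀ c → c < N t → codeOf t d c ≡ codeOf t d′ c) →
  lookupℕ d 0 ≡ lookupℕ d′ 0 → lookupℕ d (N t) ≡ lookupℕ d′ (N t) → d ≡ d′
code-injective t d d′ same-code same₀ sameₙ = lookupℕ-ext d d′ same-value
  where
  same-value : ∀ x → x < suc (N t) → lookupℕ d x ≡ lookupℕ d′ x
  same-value x x<n+1 with m≤n⇒m<n∨m≡n (≤-pred x<n+1)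
  ... | inj₁ x<n  = code-values-injective t (lookupℕ d) (lookupℕ d′) same-code same₀ sameₙ x x<n
  ... | inj₂ refl = sameₙ

xorSum-code : ∀ t D → xorSum (N t) (code t D) ≡ false
xorSum-code t D = begin
  xorSum (N t) (code t D)
    ≡⟨ xorSum-cong (N t) (λ c _ → sym (xor-assoc (D c) (D (suc c)) (ends c))) ⟩
  xorSum (N t) (λ c → (D c xor D (suc c)) xor ends c)
    ≡⟨ xorSum-xor (N t) (λ c → D c xor D (suc c)) ends ⟩
  xorSum (N t) (λ c → D c xor D (suc c)) xor xorSum (N t) ends
    ≡⟨ cong₂ _xor_ (xorSum-telescope (N t) D) (xorSum-xor (N t) (λ c → (c ≡ᵇ 1) ∧ D 0) (λ c → (c ≡ᵇ 3 + t) ∧ D (N t))) ⟩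
  (D 0 xor D (N t)) xor (xorSum (N t) (λ c → (c ≡ᵇ 1) ∧ D 0) xor xorSum (N t) (λ c → (c ≡ᵇ 3 + t) ∧ D (N t)))
    ≡⟨ cong ((D 0 xor D (N t)) xor_) (cong₂ _xor_ (xorSum-indicator (N t) 1 (λ _ → D 0) (s≤s (s≤s z≤n)))
                                                  (xorSum-indicator (N t) (3 + t) (λ _ → D (N t)) (m≤n+m (4 + t) 1))) ⟩
  (D 0 xor D (N t)) xor (D 0 xor D (N t))
    ≡⟨ xor-same (D 0 xor D (N t)) ⟩
  false ∎
  where
  open ≡-Reasoning
  ends : ℕ → Bool
  ends c = ((c ≡ᵇ 1) ∧ D 0) xor ((c ≡ᵇ 3 + t) ∧ D (N t))

codeWeight-even : ∀ t d → Σ ℕ λ h → codeWeight t d ≡ 2 * h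
codeWeight-even t d with count-parity (N t) (codeOf t d)
... | h , w≡ = h , trans w≡ (cong (λ z → bit z + 2 * h) (xorSum-code t (lookupℕ d)))

codeWeight≤2*weight : ∀ t (d : Lab t) → codeWeight t d ≤ 2 * weight d
codeWeight≤2*weight t d = begin
  codeWeight t d
    ≤⟨ sumTo-mono (N t) (λ c _ → bit-code c) ⟩
  sumTo (N t) (λ c → bit (D c) + (bit (D (suc c)) + (ends₀ c + endsₙ c)))
    ≡⟨ trans (sumTo-+ (N t) (λ c → bit (D c)) (λ c → bit (D (suc c)) + (ends₀ c + endsₙ c))) (cong (sumTo (N t) (λ c → bit (D c)) +_)
         (trans (sumTo-+ (N t) (λ c → bit (D (suc c))) (λ c → ends₀ c + endsₙ c)) (cong (sumTo (N t) (λ c → bit (D (suc c))) +_)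
           (trans (sumTo-+ (N t) ends₀ endsₙ)
             (cong₂ _+_ (sumTo-indicator (N t) 1 (D 0) (s≤s (s≤s z≤n))) (sumTo-indicator (N t) (3 + t) (D (N t)) (m≤n+m (4 + t) 1))))))) ⟩
  sumTo (N t) (λ c → bit (D c)) + (sumTo (N t) (λ c → bit (D (suc c))) + (bit (D 0) + bit (D (N t))))
    ≡⟨ rearrange (sumTo (N t) (λ c → bit (D c))) (sumTo (N t) (λ c → bit (D (suc c)))) (bit (D 0)) (bit (D (N t))) ⟩
  (sumTo (N t) (λ c → bit (D c)) + bit (D (N t))) + (bit (D 0) + sumTo (N t) (λ c → bit (D (suc c))))
    ≡⟨ cong (_+ (bit (D 0) + sumTo (N t) (λ c → bit (D (suc c))))) (sym (sumTo-snoc (N t) (λ c → bit (D c)))) ⟩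
  weight′ + weight′
    ≡⟨ cong₂ _+_ (sym (weight≡sumTo d)) (sym (weight≡sumTo d)) ⟩
  weight d + weight d
    ≡⟨ cong (weight d +_) (sym (+-identityʳ (weight d))) ⟩
  2 * weight d ∎
  where
  open ≤-Reasoning
  D = lookupℕ d
  weight′ = sumTo (suc (N t)) (λ c → bit (D c))
  ends₀ endsₙ : ℕ → ℕ
  ends₀ c = bit ((c ≡ᵇ 1) ∧ D 0)
  endsₙ c = bit ((c ≡ᵇ 3 + t) ∧ D (N t))
  rearrange : ∀ a b c e → a + (b + (c + e)) ≡ (a + e) + (c + b)
  rearrange = solve-∀
  bit-code : ∀ c → bit (code t D c) ≤ bit (D c) + (bit (D (suc c)) + (ends₀ c + endsₙ c))
  bit-code c = ≤-trans (bit-xor (D c) _) (+-monoʳ-≤ (bit (D c)) (≤-trans (bit-xor (D (suc c)) _)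
                 (+-monoʳ-≤ (bit (D (suc c))) (bit-xor ((c ≡ᵇ 1) ∧ D 0) _))))

alternating-xor : ∀ (par : ℕ → Bool) → (∀ j → par (suc j) ≡ not (par j)) → ∀ lo hi → lo ≤ hi → par lo ≡ true → par hi ≡ true →
  ∀ c → ((lo ≤ᵇ c) ∧ (c ≤ᵇ hi) ∧ par c) xor ((lo ≤ᵇ suc c) ∧ (suc c ≤ᵇ hi) ∧ par (suc c)) ≡ (lo ≤ᵇ suc c) ∧ (c ≤ᵇ hi)
alternating-xor par par-suc lo hi lo≤hi par-lo par-hi c with <-cmp (suc c) lo
... | tri< c+1<lo _ _ rewrite ≤ᵇ-false {lo} {c} (≤-trans (n≤1+n _) c+1<lo) | ≤ᵇ-false {lo} {suc c} c+1<lo = refl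
... | tri≈ _ refl _ rewrite ≤ᵇ-false {suc c} {c} ≤-refl | ≤ᵇ-true {suc c} {suc c} ≤-refl | ≤ᵇ-true lo≤hi | par-lo
                          | ≤ᵇ-true (≤-trans (n≤1+n c) lo≤hi) = refl
... | tri> _ _ lo<c+1 with <-cmp c hi
...   | tri< c<hi _ _ rewrite ≤ᵇ-true {lo} {c} (≤-pred lo<c+1) | ≤ᵇ-true {c} {hi} (<⇒≤ c<hi) | ≤ᵇ-true {lo} {suc c} (<⇒≤ lo<c+1)
                            | ≤ᵇ-true c<hi | par-suc c = xor-inverseʳ (par c)
...   | tri≈ _ refl _ rewrite ≤ᵇ-true {lo} {c} (≤-pred lo<c+1) | ≤ᵇ-true {c} {c} ≤-refl | ≤ᵇ-true {lo} {suc c} (<⇒≤ lo<c+1)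
                            | ≤ᵇ-false {suc c} {c} ≤-refl | par-hi = refl
...   | tri> _ _ hi<c rewrite ≤ᵇ-true {lo} {c} (≤-pred lo<c+1) | ≤ᵇ-false {c} {hi} hi<c | ≤ᵇ-true {lo} {suc c} (<⇒≤ lo<c+1)
                            | ≤ᵇ-false {suc c} {hi} (≤-trans hi<c (n≤1+n c)) = refl

evens-0 : ∀ x → evens 0 x ≡ false
evens-0 zero          = refl
evens-0 (suc zero)    = refl
evens-0 (suc (suc x)) = refl

code-evens : ∀ t i → 2 * i < N t → ∀ c → code t (evens i) c ≡ holed (2 * i) 0 c
code-evens t zero _ c = trans (code-ends-false t (evens 0) c refl refl) (trans (cong₂ _xor_ (evens-0 c) (evens-0 (suc c))) (empty c))
  where
  empty : ∀ c → false ≡ holed 0 0 c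
  empty zero    = refl
  empty (suc c) = refl
code-evens t (suc i) 2i+2<n c = trans (code-ends-false t (evens (suc i)) c refl evensₙ)
  (trans (alternating-xor isEven isEven-suc 2 (2 * suc i) (≤-trans (s≤s (s≤s z≤n)) (≤-reflexive (sym (*-suc 2 i)))) refl (isEven-2* (suc i)) c)
    (interval c))
  where
  evensₙ : evens (suc i) (N t) ≡ false
  evensₙ = cong (λ z → true ∧ z) (cong (_∧ isEven (N t)) (≤ᵇ-false {N t} {2 * suc i} 2i+2<n))
  interval : ∀ c → (2 ≤ᵇ suc c) ∧ (c ≤ᵇ 2 * suc i) ≡ holed (2 * suc i) 0 c
  interval zero    = refl
  interval (suc c) = sym (∧-identityʳ _)

weight-evens′ : ∀ i → sumTo (suc (2 * i)) (λ x → bit (evens i x)) ≡ i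
weight-evens′ zero    = refl
weight-evens′ (suc i) = begin
  sumTo (suc (2 * suc i)) E
    ≡⟨ cong (λ z → sumTo (suc z) E) (*-suc 2 i) ⟩
  sumTo (3 + 2 * i) E
    ≡⟨ trans (sumTo-snoc (2 + 2 * i) E) (cong (_+ E (2 + 2 * i)) (sumTo-snoc (suc (2 * i)) E)) ⟩
  sumTo (suc (2 * i)) E + E (suc (2 * i)) + E (2 + 2 * i)
    ≡⟨ cong₂ _+_ (cong₂ _+_ (sumTo-cong (suc (2 * i)) (λ x x<2i+1 → cong bit (below x (≤-pred x<2i+1)))) odd-gap) new-even ⟩
  sumTo (suc (2 * i)) (λ x → bit (evens i x)) + 0 + 1
    ≡⟨ cong (λ z → z + 0 + 1) (weight-evens′ i) ⟩
  i + 0 + 1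
    ≡⟨ trans (cong (_+ 1) (+-identityʳ i)) (+-comm i 1) ⟩
  suc i ∎
  where
  open ≡-Reasoning
  E : ℕ → ℕ
  E x = bit (evens (suc i) x)
  below : ∀ x → x ≤ 2 * i → evens (suc i) x ≡ evens i x
  below x x≤2i = cong (λ z → (2 ≤ᵇ x) ∧ z ∧ isEven x)
    (trans (≤ᵇ-true (≤-trans x≤2i (≤-trans (m≤n+m (2 * i) 2) (≤-reflexive (sym (*-suc 2 i)))))) (sym (≤ᵇ-true x≤2i)))
  odd-gap : E (suc (2 * i)) ≡ 0
  odd-gap = cong bit (trans (cong (λ z → (2 ≤ᵇ suc (2 * i)) ∧ (suc (2 * i) ≤ᵇ 2 * suc i) ∧ z)
                              (trans (isEven-suc (2 * i)) (cong not (isEven-2* i))))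
                       (trans (cong ((2 ≤ᵇ suc (2 * i)) ∧_) (∧-zeroʳ _)) (∧-zeroʳ _)))
  new-even : E (2 + 2 * i) ≡ 1
  new-even = cong bit (cong₂ (λ a b → true ∧ a ∧ b) (≤ᵇ-true (≤-reflexive (sym (*-suc 2 i)))) (trans (isEven-2+ (2 * i)) (isEven-2* i)))

weight-evens : ∀ i m → 2 * i < m → sumTo m (λ x → bit (evens i x)) ≡ i
weight-evens i m 2i<m = trans (cong (λ z → sumTo z (λ x → bit (evens i x))) (sym (m+[n∸m]≡n 2i<m)))
  (trans (sumTo-tail-0 (suc (2 * i)) (m ∸ suc (2 * i)) (λ x → bit (evens i x)) beyond) (weight-evens′ i))
  where
  beyond : ∀ x → suc (2 * i) ≤ x → bit (evens i x) ≡ 0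
  beyond x 2i<x = cong bit (trans (cong (λ w → (2 ≤ᵇ x) ∧ w ∧ isEven x) (≤ᵇ-false 2i<x)) (∧-zeroʳ _))

codeδ-end₀ : ∀ t a c → a ≤ 1 → codeδ t a c ≡ (c ≡ᵇ 0) xor (c ≡ᵇ 1)
codeδ-end₀ t 0 c _ = codeδ-0 t c
codeδ-end₀ t 1 c _ = codeδ-path t 0 c z≤n
codeδ-end₀ t (suc (suc a)) c (s≤s ())

codeδ-endₙ : ∀ t b c → 4 + t ≤ b → b ≤ N t → c < N t → codeδ t b c ≡ (c ≡ᵇ 3 + t) xor (c ≡ᵇ 4 + t)
codeδ-endₙ t b c 4+t≤b b≤n c<n with m≤n⇒m<n∨m≡n b≤n
... | inj₂ refl = codeδ-n t c c<n
... | inj₁ b<n rewrite ≤-antisym (≤-pred b<n) 4+t≤b = codeδ-n∸1 t c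

≤ᵇ1 : ∀ x → (x ≤ᵇ 1) ≡ (x ≡ᵇ 0) xor (x ≡ᵇ 1)
≤ᵇ1 zero          = refl
≤ᵇ1 (suc zero)    = refl
≤ᵇ1 (suc (suc x)) = refl

4+t≤ᵇ : ∀ t x → x ≤ N t → (4 + t ≤ᵇ x) ≡ (x ≡ᵇ 4 + t) xor (x ≡ᵇ N t)
4+t≤ᵇ t x x≤n with <-cmp x (4 + t)
... | tri< x<4+t _ _ = trans (≤ᵇ-false {4 + t} {x} x<4+t)
      (sym (cong₂ _xor_ (≡ᵇ-false x _ (<⇒≢ x<4+t)) (≡ᵇ-false x (N t) (<⇒≢ (≤-trans x<4+t (n≤1+n _))))))
... | tri≈ _ refl _ = trans (≤ᵇ-true {4 + t} ≤-refl) (sym (cong₂ _xor_ (≡ᵇ-refl x) (≡ᵇ-false x (N t) (n≢1+n x))))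
... | tri> _ _ 4+t<x rewrite ≤-antisym x≤n 4+t<x =
      trans (≤ᵇ-true {4 + t} (n≤1+n _)) (sym (cong₂ _xor_ (≡ᵇ-false (N t) _ (≢-sym (n≢1+n _))) (≡ᵇ-refl (N t))))

code-ℓl : ∀ t c → c < N t → code t (λ x → x ≤ᵇ 1) c ≡ false
code-ℓl t c c<n = trans (code-cong t _ (λ x → (x ≡ᵇ 0) xor (x ≡ᵇ 1)) (λ x _ → ≤ᵇ1 x) c c<n)
  (trans (code-xor t (λ x → x ≡ᵇ 0) (λ x → x ≡ᵇ 1) c)
    (trans (cong₂ _xor_ (codeδ-end₀ t 0 c z≤n) (codeδ-end₀ t 1 c ≤-refl)) (xor-same ((c ≡ᵇ 0) xor (c ≡ᵇ 1)))))

code-ℓr : ∀ t c → c < N t → code t (λ x → 4 + t ≤ᵇ x) c ≡ false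
code-ℓr t c c<n = trans (code-cong t _ (λ x → (x ≡ᵇ 4 + t) xor (x ≡ᵇ N t)) (4+t≤ᵇ t) c c<n)
  (trans (code-xor t (λ x → x ≡ᵇ 4 + t) (λ x → x ≡ᵇ N t) c)
    (trans (cong₂ _xor_ (codeδ-n∸1 t c) (codeδ-n t c c<n)) (xor-same ((c ≡ᵇ 3 + t) xor (c ≡ᵇ 4 + t)))))

code-ℓc : ∀ t c → c < N t → code t (λ x → (x ≤ᵇ 1) ∨ (4 + t ≤ᵇ x)) c ≡ false
code-ℓc t c c<n = trans (code-disjoint-∨ t (λ x → x ≤ᵇ 1) (λ x → 4 + t ≤ᵇ x) apart c c<n)
  (cong₂ _xor_ (code-ℓl t c c<n) (code-ℓr t c c<n))
  where
  apart : ∀ x → (x ≤ᵇ 1) ∧ (4 + t ≤ᵇ x) ≡ false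
  apart zero          = refl
  apart (suc zero)    = refl
  apart (suc (suc x)) = refl

oddsBetween : ℕ → ℕ → Bool
oddsBetween t x = (3 ≤ᵇ x) ∧ (x ≤ᵇ 2 + t) ∧ isOdd x

oddsBetween-> : ∀ t x → 2 + t < x → oddsBetween t x ≡ false
oddsBetween-> t x 2+t<x = trans (cong (λ z → (3 ≤ᵇ x) ∧ (z ∧ isOdd x)) (≤ᵇ-false {x} {2 + t} 2+t<x)) (∧-zeroʳ _)

code-oddsBetween : ∀ t → 1 ≤ t → isOdd (2 + t) ≡ true → ∀ c → code t (oddsBetween t) c ≡ (3 ≤ᵇ suc c) ∧ (c ≤ᵇ 2 + t)
code-oddsBetween t 1≤t odd c =
  trans (code-ends-false t (oddsBetween t) c refl (oddsBetween-> t (N t) (m≤n+m (3 + t) 2)))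
    (alternating-xor isOdd isOdd-suc 3 (2 + t) (s≤s (s≤s 1≤t)) refl odd c)

code-evenExtra : ∀ t a b → a ≤ 1 → 4 + t ≤ b → b ≤ N t → 1 ≤ t → isOdd (2 + t) ≡ true →
  ∀ c → c < N t → code t (λ x → (x ≡ᵇ a) ∨ (x ≡ᵇ b) ∨ oddsBetween t x) c ≡ true
code-evenExtra t a b a≤1 4+t≤b b≤n 1≤t odd c c<n = begin
  code t (λ x → (x ≡ᵇ a) ∨ (x ≡ᵇ b) ∨ oddsBetween t x) c
    ≡⟨ code-disjoint-∨ t (λ x → x ≡ᵇ a) _ (only-at (λ x → (x ≡ᵇ b) ∨ oddsBetween t x) a a-apart) c c<n ⟩
  codeδ t a c xor code t (λ x → (x ≡ᵇ b) ∨ oddsBetween t x) c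
    ≡⟨ cong (codeδ t a c xor_) (code-disjoint-∨ t (λ x → x ≡ᵇ b) (oddsBetween t) (only-at (oddsBetween t) b b-apart) c c<n) ⟩
  codeδ t a c xor (codeδ t b c xor code t (oddsBetween t) c)
    ≡⟨ cong₂ _xor_ (codeδ-end₀ t a c a≤1) (cong₂ _xor_ (codeδ-endₙ t b c 4+t≤b b≤n c<n) (code-oddsBetween t 1≤t odd c)) ⟩
  ((c ≡ᵇ 0) xor (c ≡ᵇ 1)) xor (((c ≡ᵇ 3 + t) xor (c ≡ᵇ 4 + t)) xor ((3 ≤ᵇ suc c) ∧ (c ≤ᵇ 2 + t)))
    ≡⟨ covers c c<n ⟩
  true ∎
  where
  open ≡-Reasoning
  4+t≰1 : 4 + t ≤ 1 → ⊥
  4+t≰1 (s≤s ())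
  b-apart : oddsBetween t b ≡ false
  b-apart = oddsBetween-> t b (≤-trans (n≤1+n _) 4+t≤b)
  a-apart : (a ≡ᵇ b) ∨ oddsBetween t a ≡ false
  a-apart rewrite ≡ᵇ-false a b (λ { refl → 4+t≰1 (≤-trans 4+t≤b a≤1) }) = oddsBetween-a a≤1
    where
    oddsBetween-a : a ≤ 1 → oddsBetween t a ≡ false
    oddsBetween-a z≤n       = refl
    oddsBetween-a (s≤s z≤n) = refl
  covers : ∀ c → c < N t → ((c ≡ᵇ 0) xor (c ≡ᵇ 1)) xor (((c ≡ᵇ 3 + t) xor (c ≡ᵇ 4 + t)) xor ((3 ≤ᵇ suc c) ∧ (c ≤ᵇ 2 + t))) ≡ true
  covers zero          _ = refl
  covers (suc zero)    _ = refl
  covers (suc (suc c)) c+2<n with <-cmp c (suc t)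
  ... | tri< c<1+t _ _ rewrite ≡ᵇ-false (2 + c) (3 + t) (λ e → <⇒≢ c<1+t (suc-injective (suc-injective e)))
                             | ≡ᵇ-false (2 + c) (4 + t) (λ e → <⇒≢ (≤-trans c<1+t (n≤1+n _)) (suc-injective (suc-injective e)))
                             | ≤ᵇ-true {2 + c} {2 + t} (s≤s (s≤s (≤-pred c<1+t))) = refl
  ... | tri≈ _ refl _ rewrite ≡ᵇ-refl (3 + t) | ≡ᵇ-false (3 + t) (4 + t) (n≢1+n _) | ≤ᵇ-false {3 + t} {2 + t} ≤-refl = refl
  ... | tri> _ _ 1+t<c rewrite ≤-antisym (≤-pred (≤-pred (≤-pred c+2<n))) 1+t<c
                             | ≡ᵇ-refl (4 + t) | ≡ᵇ-false (4 + t) (3 + t) (≢-sym (n≢1+n _)) | ≤ᵇ-false {4 + t} {2 + t} (n≤1+n _) = refl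

code-oddExtra : ∀ t i → 2 * i ≡ 2 + t → ∀ c → c < N t →
  code t (λ x → evens i x ∨ (x ≡ᵇ 4 + t)) c ≡ holed (4 + t) 0 c
code-oddExtra t i 2i≡2+t c c<n = begin
  code t (λ x → evens i x ∨ (x ≡ᵇ 4 + t)) c
    ≡⟨ code-disjoint-∨ t (evens i) (λ x → x ≡ᵇ 4 + t) apart c c<n ⟩
  code t (evens i) c xor codeδ t (4 + t) c
    ≡⟨ cong₂ _xor_ (trans (code-evens t i (subst (_< N t) (sym 2i≡2+t) (m≤n+m (3 + t) 2)) c) (cong (λ z → holed z 0 c) 2i≡2+t))
                   (codeδ-n∸1 t c) ⟩
  holed (2 + t) 0 c xor ((c ≡ᵇ 3 + t) xor (c ≡ᵇ 4 + t))
    ≡⟨ extend c c<n ⟩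
  holed (4 + t) 0 c ∎
  where
  open ≡-Reasoning
  apart : ∀ x → evens i x ∧ (x ≡ᵇ 4 + t) ≡ false
  apart x = trans (∧-comm (evens i x) _) (only-at (evens i) (4 + t)
    (trans (cong (λ z → (2 ≤ᵇ 4 + t) ∧ (4 + t ≤ᵇ z) ∧ isEven (4 + t)) 2i≡2+t)
           (cong (λ z → true ∧ z ∧ isEven (4 + t)) (≤ᵇ-false {4 + t} {2 + t} (m≤n+m (3 + t) 1)))) x)
  extend : ∀ c → c < N t → holed (2 + t) 0 c xor ((c ≡ᵇ 3 + t) xor (c ≡ᵇ 4 + t)) ≡ holed (4 + t) 0 c
  extend zero    _     = refl
  extend (suc c) c+1<n rewrite ∧-identityʳ (suc c ≤ᵇ 2 + t) | ∧-identityʳ (suc c ≤ᵇ 4 + t) with <-cmp c (2 + t)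
  ... | tri< c<2+t _ _ rewrite ≤ᵇ-true {suc c} {2 + t} c<2+t | ≡ᵇ-false (suc c) (3 + t) (λ e → <⇒≢ c<2+t (suc-injective e))
                             | ≡ᵇ-false (suc c) (4 + t) (λ e → <⇒≢ (≤-trans c<2+t (n≤1+n _)) (suc-injective e))
                             | ≤ᵇ-true {suc c} {4 + t} (≤-trans c<2+t (m≤n+m (2 + t) 2)) = refl
  ... | tri≈ _ refl _ rewrite ≤ᵇ-false {3 + t} {2 + t} ≤-refl | ≡ᵇ-refl (3 + t) | ≡ᵇ-false (3 + t) (4 + t) (n≢1+n _)
                            | ≤ᵇ-true {3 + t} {4 + t} (n≤1+n _) = refl
  ... | tri> _ _ 2+t<c rewrite ≤-antisym (≤-pred (≤-pred c+1<n)) 2+t<c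
                             | ≤ᵇ-false {4 + t} {2 + t} (n≤1+n _) | ≡ᵇ-false (4 + t) (3 + t) (≢-sym (n≢1+n _)) | ≡ᵇ-refl (4 + t)
                             | ≤ᵇ-true {4 + t} {4 + t} ≤-refl = refl

rigidIndex : Bool → Bool → ℕ
rigidIndex true  false = 0
rigidIndex false true  = 1
rigidIndex true  true  = 2
rigidIndex false false = 3

fullIndex : Bool → Bool → ℕ
fullIndex true  false = 0
fullIndex true  true  = 1
fullIndex false false = 2
fullIndex false true  = 3

rigidIndex<4 : ∀ a b → rigidIndex a b < 4
rigidIndex<4 true  false = s≤s z≤n
rigidIndex<4 false true  = s≤s (s≤s z≤n)
rigidIndex<4 true  true  = s≤s (s≤s (s≤s z≤n))
rigidIndex<4 false false = ≤-refl

fullIndex<4 : ∀ a b → fullIndex a b < 4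
fullIndex<4 true  false = s≤s z≤n
fullIndex<4 true  true  = s≤s (s≤s z≤n)
fullIndex<4 false false = s≤s (s≤s (s≤s z≤n))
fullIndex<4 false true  = ≤-refl

-- The position of a class in the lists of the statement: first the classes with w = 0, by (d_0 , d_n),
-- then one class for each w = 2, 4, …, then (for even n) the classes with w = n.
classIndex′ : ℕ → ℕ → ℕ → Bool → Bool → ℕ
classIndex′ k n w a b = if w ≡ᵇ 0 then rigidIndex a b else (if w ≡ᵇ n then 3 + k + fullIndex a b else 3 + ⌊ w /2⌋)

classIndex : ∀ t → ℕ → Lab t → ℕ
classIndex t k d = classIndex′ k (N t) (codeWeight t d) (lookupℕ d 0) (lookupℕ d (N t))

classIndex′-middle : ∀ k n w a b → w ≢ 0 → w ≢ n → classIndex′ k n w a b ≡ 3 + ⌊ w /2⌋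
classIndex′-middle k n w a b w≢0 w≢n rewrite ≡ᵇ-false w 0 w≢0 | ≡ᵇ-false w n w≢n = refl

classIndex-invariant : ∀ t k {d d′} → Equiv (Tree t) d d′ → classIndex t k d ≡ classIndex t k d′
classIndex-invariant t k {d} {d′} eq with codeWeight t d ≟ 0 | codeWeight t d ≟ N t
... | yes w≡0 | _ = cong₂ (λ w ends → classIndex′ k (N t) w (proj₁ ends) (proj₂ ends))
                      (codeWeight-invariant t eq) (uncurry (cong₂ _,_) (ends-invariant t eq (inj₁ w≡0)))
... | no _ | yes w≡n = cong₂ (λ w ends → classIndex′ k (N t) w (proj₁ ends) (proj₂ ends))
                         (codeWeight-invariant t eq) (uncurry (cong₂ _,_) (ends-invariant t eq (inj₂ w≡n)))
... | no w≢0 | no w≢n = begin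
  classIndex t k d               ≡⟨ classIndex′-middle k (N t) _ _ _ w≢0 w≢n ⟩
  3 + ⌊ codeWeight t d /2⌋       ≡⟨ cong (λ w → 3 + ⌊ w /2⌋) w≡w′ ⟩
  3 + ⌊ codeWeight t d′ /2⌋      ≡⟨ sym (classIndex′-middle k (N t) _ _ _ (w≢0 ∘ trans w≡w′) (w≢n ∘ trans w≡w′)) ⟩
  classIndex t k d′              ∎
  where
  open ≡-Reasoning
  w≡w′ = codeWeight-invariant t eq

record Profile (t : ℕ) (r : Lab t) (V : ℕ → Bool) (a b : Bool) : Set where
  constructor profile
  field
    code≡ : ∀ c → c < N t → codeOf t r c ≡ V c
    end₀≡ : lookupℕ r 0 ≡ a
    endₙ≡ : lookupℕ r (N t) ≡ b

same-Profile⇒≡ : ∀ {t d r V a b} → Profile t d V a b → Profile t r V a b → d ≡ r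
same-Profile⇒≡ {t} {d} {r} (profile code-d d₀ dₙ) (profile code-r r₀ rₙ) =
  code-injective t d r (λ c c<n → trans (code-d c c<n) (sym (code-r c c<n))) (trans d₀ (sym r₀)) (trans dₙ (sym rₙ))

Profile-mkLab : ∀ t (P : ℕ → Bool) → Profile t (mkLab (N t) P) (code t P) (P 0) (P (N t))
Profile-mkLab t P = profile
  (code-cong t _ P (λ x x≤n → lookupℕ-tabulate (suc (N t)) P x (s≤s x≤n)))
  (lookupℕ-tabulate (suc (N t)) P 0 (s≤s z≤n))
  (lookupℕ-tabulate (suc (N t)) P (N t) ≤-refl)

weight-mkLab : ∀ n (P : ℕ → Bool) → weight (mkLab n P) ≡ sumTo (suc n) (λ x → bit (P x))
weight-mkLab n P = trans (weight≡sumTo (mkLab n P)) (sumTo-cong (suc n) (λ x x<n+1 → cong bit (lookupℕ-tabulate (suc n) P x x<n+1)))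

classIndex-Profile : ∀ {t k r V a b} → Profile t r V a b → classIndex t k r ≡ classIndex′ k (N t) (count (N t) V) a b
classIndex-Profile {t} {k} (profile code≡ end₀≡ endₙ≡) =
  cong₂ (λ w ends → classIndex′ k (N t) w (proj₁ ends) (proj₂ ends)) (count-cong (N t) code≡) (cong₂ _,_ end₀≡ endₙ≡)

ConstantCode⇒singleton : ∀ t {d r} → Equiv (Tree t) d r → ConstantCode t r → d ≡ r
ConstantCode⇒singleton t {d} {r} eq constant = same-Profile⇒≡ {V = codeOf t r}
  (profile (same-code constant) (proj₁ same-ends) (proj₂ same-ends)) (profile (λ _ _ → refl) refl refl)
  where
  w≡w′ = codeWeight-invariant t eq
  extreme : ConstantCode t r → Extreme t d
  extreme (inj₁ all-false) = inj₁ (trans w≡w′ (count-false (N t) (codeOf t r) all-false))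
  extreme (inj₂ all-true)  = inj₂ (trans w≡w′ (trans (count-cong (N t) all-true) (count-true (N t))))
  same-ends = ends-invariant t eq (extreme constant)
  same-code : ConstantCode t r → ∀ c → c < N t → codeOf t d c ≡ codeOf t r c
  same-code (inj₁ all-false) c c<n = trans (count≡0⇒false (N t) (codeOf t d) (trans w≡w′ (count-false (N t) _ all-false)) c c<n) (sym (all-false c c<n))
  same-code (inj₂ all-true)  c c<n = trans (count≡m⇒true (N t) (codeOf t d) (trans w≡w′ (trans (count-cong (N t) all-true) (count-true (N t)))) c c<n) (sym (all-true c c<n))

weight-minimal : ∀ t {d r} h → Equiv (Tree t) d r → codeWeight t r ≡ 2 * h → weight r ≡ h → weight r ≤ weight d
weight-minimal t {d} h eq w≡2h weight≡h = subst (_≤ weight d) (sym weight≡h)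
  (*-cancelˡ-≤ 2 (subst (_≤ 2 * weight d) (trans (codeWeight-invariant t eq) w≡2h) (codeWeight≤2*weight t d)))

same-Profile⇒Equiv : ∀ {t d r V a b} → Profile t d V a b → Profile t r V a b → Equiv (Tree t) d r
same-Profile⇒Equiv {t} {d} d-profile r-profile = subst (Equiv (Tree t) d) (same-Profile⇒≡ d-profile r-profile) ε

reach-middle : ∀ t {d r} h → codeWeight t d ≡ 2 * h → 1 ≤ h → 2 * h < N t →
  Profile t r (holed (2 * h) 0) false false → Equiv (Tree t) d r
reach-middle t {d} (suc h) w≡2h+2 _ 2h+2<n r-profile
  with reach-normalForm t d (suc (2 * h)) (trans w≡2h+2 (*-suc 2 h)) (≤-pred (≤-pred (subst (_< N t) (*-suc 2 h) 2h+2<n)))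
... | reach d′ eq code≡ end₀≡ endₙ≡ = eq ◅◅ same-Profile⇒Equiv
  (profile (λ c c<n → trans (code≡ c c<n) (cong (λ z → holed z 0 c) (sym (*-suc 2 h)))) end₀≡ endₙ≡) r-profile


Profile-cong : ∀ {t r V V′ a a′ b b′} → (∀ c → c < N t → V c ≡ V′ c) → a ≡ a′ → b ≡ b′ →
  Profile t r V a b → Profile t r V′ a′ b′
Profile-cong V≗V′ refl refl (profile code≡ end₀≡ endₙ≡) = profile (λ c c<n → trans (code≡ c c<n) (V≗V′ c c<n)) end₀≡ endₙ≡

classIndex′-full : ∀ k t a b → classIndex′ k (N t) (N t) a b ≡ 3 + k + fullIndex a b
classIndex′-full k t a b rewrite ≡ᵇ-refl t = refl

classIndex′-middle-even : ∀ k n i → 2 * i < n → classIndex′ k n (2 * i) false false ≡ 3 + i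
classIndex′-middle-even k n zero    _      = refl
classIndex′-middle-even k n (suc i) 2i+2<n = trans
  (classIndex′-middle k n (2 * suc i) false false (λ 2i+2≡0 → 0≢1+n (sym (trans (sym (*-suc 2 i)) 2i+2≡0))) (<⇒≢ 2i+2<n))
  (cong (3 +_) (⌊2*n/2⌋≡n (suc i)))

module Representatives (t : ℕ) where

  n : ℕ
  n = N t

  chainRep : ℕ → Lab t
  chainRep i = mkLab n (evens i)

  rigidRep : Bool → Bool → Lab t
  rigidRep true  false = ℓl n
  rigidRep false true  = ℓr n
  rigidRep true  true  = ℓc n
  rigidRep false false = chainRep 0

  Profile-chainRep : ∀ i → 2 * i < n → Profile t (chainRep i) (holed (2 * i) 0) false false
  Profile-chainRep i 2i<n = Profile-cong (λ c _ → code-evens t i 2i<n c) refl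
    (cong (λ z → true ∧ z ∧ isEven n) (≤ᵇ-false {n} {2 * i} 2i<n)) (Profile-mkLab t (evens i))

  weight-chainRep : ∀ i → 2 * i < n → weight (chainRep i) ≡ i
  weight-chainRep i 2i<n = trans (weight-mkLab n (evens i)) (weight-evens i (suc n) (≤-trans 2i<n (n≤1+n _)))

  Profile-rigidRep : ∀ a b → Profile t (rigidRep a b) (λ _ → false) a b
  Profile-rigidRep true  false = Profile-cong (code-ℓl t) refl refl (Profile-mkLab t (λ x → x ≤ᵇ 1))
  Profile-rigidRep false true  = Profile-cong (code-ℓr t) refl (≤ᵇ-true {4 + t} (n≤1+n _)) (Profile-mkLab t (λ x → 4 + t ≤ᵇ x))
  Profile-rigidRep true  true  = Profile-cong (code-ℓc t) refl (≤ᵇ-true {4 + t} (n≤1+n _)) (Profile-mkLab t (λ x → (x ≤ᵇ 1) ∨ (4 + t ≤ᵇ x)))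
  Profile-rigidRep false false = Profile-cong (λ c _ → holed-0 c) refl refl (Profile-chainRep 0 (s≤s z≤n))
    where
    holed-0 : ∀ c → holed 0 0 c ≡ false
    holed-0 zero    = refl
    holed-0 (suc c) = refl

  reach-rigidRep : ∀ d → codeWeight t d ≡ 0 → Equiv (Tree t) d (rigidRep (lookupℕ d 0) (lookupℕ d n))
  reach-rigidRep d w≡0 = same-Profile⇒Equiv (profile (count≡0⇒false n (codeOf t d) w≡0) refl refl) (Profile-rigidRep _ _)

  classIndex-rigidRep : ∀ k a b → classIndex t k (rigidRep a b) ≡ rigidIndex a b
  classIndex-rigidRep k a b = trans (classIndex-Profile (Profile-rigidRep a b)) (cong (λ w → classIndex′ k n w a b) (count-false n _ (λ _ _ → refl)))

  minimal-rigidRep : ∀ a b d → Equiv (Tree t) d (rigidRep a b) → weight (rigidRep a b) ≤ weight d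
  minimal-rigidRep a b d eq = ≤-reflexive (cong weight (sym (ConstantCode⇒singleton t eq (inj₁ (Profile.code≡ (Profile-rigidRep a b))))))

  classIndex-chainRep : ∀ k i → 2 * i < n → classIndex t k (chainRep i) ≡ 3 + i
  classIndex-chainRep k i 2i<n = trans (classIndex-Profile (Profile-chainRep i 2i<n))
    (trans (cong (λ w → classIndex′ k n w false false) (count-holed n (2 * i) 2i<n)) (classIndex′-middle-even k n i 2i<n))

  minimal-chainRep : ∀ i → 2 * i < n → ∀ d → Equiv (Tree t) d (chainRep i) → weight (chainRep i) ≤ weight d
  minimal-chainRep i 2i<n d eq = weight-minimal t i eq (trans (count-cong n (Profile.code≡ (Profile-chainRep i 2i<n))) (count-holed n (2 * i) 2i<n))
    (weight-chainRep i 2i<n)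

evenExtraPred : ℕ → ℕ → ℕ → ℕ → Bool
evenExtraPred k a b j = (j ≡ᵇ a) ∨ (j ≡ᵇ b) ∨ ((3 ≤ᵇ j) ∧ (j ≤ᵇ 2 * k ∸ 3) ∧ isOdd j)

-- repsEven k and repsOdd k with the number of vertices abstracted, so that it can be rewritten to N t.
evenReps : (k n : ℕ) → List (Labeling (suc n))
evenReps k n = ℓl n ∷ ℓr n ∷ ℓc n ∷ (chain n k ++
  (mkLab n (evenExtraPred k 0 (n ∸ 1)) ∷ mkLab n (evenExtraPred k 0 n) ∷ mkLab n (evenExtraPred k 1 (n ∸ 1)) ∷ mkLab n (evenExtraPred k 1 n) ∷ []))

module EvenCase (t k : ℕ) (2k≡n : 2 * k ≡ N t) (1≤t : 1 ≤ t) (odd : isOdd (2 + t) ≡ true) where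

  open Representatives t

  extraPred≡ : ∀ a b x → evenExtraPred k a b x ≡ (x ≡ᵇ a) ∨ (x ≡ᵇ b) ∨ oddsBetween t x
  extraPred≡ a b x = cong (λ z → (x ≡ᵇ a) ∨ (x ≡ᵇ b) ∨ ((3 ≤ᵇ x) ∧ (x ≤ᵇ z ∸ 3) ∧ isOdd x)) 2k≡n

  Profile-extra : ∀ a b → a ≤ 1 → 4 + t ≤ b → b ≤ n →
    Profile t (mkLab n (evenExtraPred k a b)) (λ _ → true) (evenExtraPred k a b 0) (n ≡ᵇ b)
  Profile-extra a b a≤1 4+t≤b b≤n = Profile-cong
    (λ c c<n → trans (code-cong t _ _ (λ x _ → extraPred≡ a b x) c c<n) (code-evenExtra t a b a≤1 4+t≤b b≤n 1≤t odd c c<n))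
    refl endₙ (Profile-mkLab t (evenExtraPred k a b))
    where
    endₙ : evenExtraPred k a b n ≡ (n ≡ᵇ b)
    endₙ rewrite extraPred≡ a b n | ≡ᵇ-false n a (λ n≡a → case ≤-trans (≤-reflexive n≡a) a≤1 of λ { (s≤s ()) })
               | oddsBetween-> t n (m≤n+m (3 + t) 2) = BP.∨-identityʳ (n ≡ᵇ b)

  n≢4+t : (n ≡ᵇ 4 + t) ≡ false
  n≢4+t = ≡ᵇ-false n (4 + t) (≢-sym (n≢1+n (4 + t)))

  fullRep : Bool → Bool → Lab t
  fullRep true  false = mkLab n (evenExtraPred k 0 (n ∸ 1))
  fullRep true  true  = mkLab n (evenExtraPred k 0 n)
  fullRep false false = mkLab n (evenExtraPred k 1 (n ∸ 1))
  fullRep false true  = mkLab n (evenExtraPred k 1 n)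

  Profile-fullRep : ∀ a b → Profile t (fullRep a b) (λ _ → true) a b
  Profile-fullRep true  false = Profile-cong (λ _ _ → refl) refl n≢4+t (Profile-extra 0 (n ∸ 1) z≤n ≤-refl (n≤1+n _))
  Profile-fullRep true  true  = Profile-cong (λ _ _ → refl) refl (≡ᵇ-refl n) (Profile-extra 0 n z≤n (n≤1+n _) ≤-refl)
  Profile-fullRep false false = Profile-cong (λ _ _ → refl) refl n≢4+t (Profile-extra 1 (n ∸ 1) (s≤s z≤n) ≤-refl (n≤1+n _))
  Profile-fullRep false true  = Profile-cong (λ _ _ → refl) refl (≡ᵇ-refl n) (Profile-extra 1 n (s≤s z≤n) (n≤1+n _) ≤-refl)

  reach-fullRep : ∀ d → codeWeight t d ≡ n → Equiv (Tree t) d (fullRep (lookupℕ d 0) (lookupℕ d n))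
  reach-fullRep d w≡n = same-Profile⇒Equiv (profile (count≡m⇒true n (codeOf t d) w≡n) refl refl) (Profile-fullRep _ _)

  classIndex-fullRep : ∀ a b → classIndex t k (fullRep a b) ≡ 3 + k + fullIndex a b
  classIndex-fullRep a b = trans (classIndex-Profile (Profile-fullRep a b))
    (trans (cong (λ w → classIndex′ k n w a b) (count-true n)) (classIndex′-full k t a b))

  minimal-fullRep : ∀ a b d → Equiv (Tree t) d (fullRep a b) → weight (fullRep a b) ≤ weight d
  minimal-fullRep a b d eq = ≤-reflexive (cong weight (sym (ConstantCode⇒singleton t eq (inj₂ (Profile.code≡ (Profile-fullRep a b))))))

  fullRepAt : ℕ → Lab t
  fullRepAt 0 = fullRep true  false
  fullRepAt 1 = fullRep true  true
  fullRepAt 2 = fullRep false false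
  fullRepAt _ = fullRep false true

  rep : ℕ → Lab t
  rep 0 = ℓl n
  rep 1 = ℓr n
  rep 2 = ℓc n
  rep (suc (suc (suc j))) = if j <ᵇ k then chainRep j else fullRepAt (j ∸ k)

  0<k : 0 < k
  0<k = *-cancelˡ-< 2 0 k (subst (0 <_) (sym 2k≡n) (s≤s z≤n))

  2i<n : ∀ {i} → i < k → 2 * i < n
  2i<n {i} i<k = subst (2 * i <_) 2k≡n (*-monoʳ-< 2 i<k)

  rep-chain : ∀ i → i < k → rep (3 + i) ≡ chainRep i
  rep-chain i i<k rewrite <ᵇ-true i<k = refl

  rep-full : ∀ a b → rep (3 + k + fullIndex a b) ≡ fullRep a b
  rep-full a b rewrite <ᵇ-false {k + fullIndex a b} {k} (m≤m+n k _) | m+n∸m≡n k (fullIndex a b) = at a b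
    where
    at : ∀ a b → fullRepAt (fullIndex a b) ≡ fullRep a b
    at true  false = refl
    at true  true  = refl
    at false false = refl
    at false true  = refl

  rep-rigid : ∀ a b → rep (rigidIndex a b) ≡ rigidRep a b
  rep-rigid true  false = refl
  rep-rigid false true  = refl
  rep-rigid true  true  = refl
  rep-rigid false false = rep-chain 0 0<k

  enumerates : Enumerates (evenReps k n) rep
  enumerates = enumerates-∷ rep refl (enumerates-∷ (λ j → rep (1 + j)) refl (enumerates-∷ (λ j → rep (2 + j)) refl
    (enumerates-map-upTo-++ chainRep k _ (λ j → rep (3 + j)) (λ i i<k → sym (rep-chain i i<k))
      (enumerates-∷ (λ e → rep (3 + (k + e))) (sym (rep-full true false))
      (enumerates-∷ (λ e → rep (3 + (k + suc e))) (sym (rep-full true true))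
      (enumerates-∷ (λ e → rep (3 + (k + suc (suc e)))) (sym (rep-full false false))
      (enumerates-∷ (λ e → rep (3 + (k + suc (suc (suc e))))) (sym (rep-full false true)) (enumerates-[] (λ e → rep (3 + (k + suc (suc (suc (suc e))))))))))))))

  length-evenReps : length (evenReps k n) ≡ k + 7
  length-evenReps = begin
    3 + length (chain n k ++ _)  ≡⟨ cong (3 +_) (length-++ (chain n k)) ⟩
    3 + (length (chain n k) + 4) ≡⟨ cong (λ l → 3 + (l + 4)) (trans (length-map _ (upTo k)) (length-upTo k)) ⟩
    3 + (k + 4)                  ≡⟨ cong (3 +_) (+-comm k 4) ⟩
    7 + k                        ≡⟨ +-comm 7 k ⟩
    k + 7                        ∎
    where open ≡-Reasoning

  fullIndex-onto : ∀ e → e < 4 → Σ Bool λ a → Σ Bool λ b → fullIndex a b ≡ e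
  fullIndex-onto 0 _ = true  , false , refl
  fullIndex-onto 1 _ = true  , true  , refl
  fullIndex-onto 2 _ = false , false , refl
  fullIndex-onto 3 _ = false , true  , refl
  fullIndex-onto (suc (suc (suc (suc e)))) (s≤s (s≤s (s≤s (s≤s ()))))

  3+k+4≡k+7 : 3 + k + 4 ≡ k + 7
  3+k+4≡k+7 = trans (cong (3 +_) (+-comm k 4)) (+-comm 7 k)

  in-range : ∀ {j} → j < k + 7 → j < length (evenReps k n)
  in-range {j} = subst (j <_) (sym length-evenReps)

  beyond-chain : ∀ j → ¬ j < k → 3 + j < length (evenReps k n) → Σ Bool λ a → Σ Bool λ b → 3 + k + fullIndex a b ≡ 3 + j
  beyond-chain j j≮k 3+j<len with fullIndex-onto (j ∸ k) (+-cancelˡ-< k (j ∸ k) 4 (subst (_< k + 4) (sym k+[j∸k]≡j) j<k+4))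
    where
    k+[j∸k]≡j = m+[n∸m]≡n (≮⇒≥ j≮k)
    j<k+4 = ≤-pred (≤-pred (≤-pred (subst (3 + j <_) (trans length-evenReps (sym 3+k+4≡k+7)) 3+j<len)))
  ... | a , b , index≡ = a , b , cong (3 +_) (trans (cong (k +_) index≡) (m+[n∸m]≡n (≮⇒≥ j≮k)))

  index-rep : ∀ j → j < length (evenReps k n) → classIndex t k (rep j) ≡ j
  index-rep 0 _ = classIndex-rigidRep k true false
  index-rep 1 _ = classIndex-rigidRep k false true
  index-rep 2 _ = classIndex-rigidRep k true true
  index-rep (suc (suc (suc j))) 3+j<len with j <? k
  ... | yes j<k = trans (cong (classIndex t k) (rep-chain j j<k)) (classIndex-chainRep k j (2i<n j<k))
  ... | no j≮k with beyond-chain j j≮k 3+j<len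
  ...   | a , b , index≡ = subst (λ i → classIndex t k (rep i) ≡ i) index≡
          (trans (cong (classIndex t k) (rep-full a b)) (classIndex-fullRep a b))

  covering : ∀ d → Σ ℕ λ j → j < length (evenReps k n) × Equiv (Tree t) d (rep j)
  covering d with codeWeight-even t d
  ... | zero , w≡0 = rigidIndex a b , in-range (≤-trans (rigidIndex<4 a b) (≤-trans (m≤m+n 4 3) (m≤n+m 7 k))) ,
                     subst (Equiv (Tree t) d) (sym (rep-rigid a b)) (reach-rigidRep d w≡0)
    where a = lookupℕ d 0 ; b = lookupℕ d n
  ... | suc h , w≡2h with codeWeight t d ≟ n
  ...   | yes w≡n = 3 + k + fullIndex a b , in-range (≤-trans (+-monoʳ-< (3 + k) (fullIndex<4 a b)) (≤-reflexive 3+k+4≡k+7)) ,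
                    subst (Equiv (Tree t) d) (sym (rep-full a b)) (reach-fullRep d w≡n)
    where a = lookupℕ d 0 ; b = lookupℕ d n
  ...   | no w≢n = 3 + suc h , in-range (≤-trans (+-monoʳ-< 3 h<k) (≤-trans (m≤m+n (3 + k) 4) (≤-reflexive 3+k+4≡k+7))) ,
                   subst (Equiv (Tree t) d) (sym (rep-chain (suc h) h<k))
                     (reach-middle t (suc h) w≡2h (s≤s z≤n) 2h<n (Profile-chainRep (suc h) 2h<n))
    where
    2h<n = subst (_< n) w≡2h (≤∧≢⇒< (count≤ n (codeOf t d)) w≢n)
    h<k = *-cancelˡ-< 2 (suc h) k (subst (2 * suc h <_) (sym 2k≡n) 2h<n)

  minimal : ∀ j → j < length (evenReps k n) → ∀ d → Equiv (Tree t) d (rep j) → weight (rep j) ≤ weight d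
  minimal 0 _ = minimal-rigidRep true false
  minimal 1 _ = minimal-rigidRep false true
  minimal 2 _ = minimal-rigidRep true true
  minimal (suc (suc (suc j))) 3+j<len with j <? k
  ... | yes j<k rewrite rep-chain j j<k = minimal-chainRep j (2i<n j<k)
  ... | no j≮k with beyond-chain j j≮k 3+j<len
  ...   | a , b , index≡ = subst (λ i → ∀ d → Equiv (Tree t) d (rep i) → weight (rep i) ≤ weight d) index≡
          (subst (λ r → ∀ d → Equiv (Tree t) d r → weight r ≤ weight d) (sym (rep-full a b)) (minimal-fullRep a b))

  evenReps-minimal : MinimalRepSystem (Tree t) (evenReps k n)
  evenReps-minimal = minimalRepSystem-byIndex (Tree t) (evenReps k n) rep (classIndex t k) enumerates (classIndex-invariant t k)
    index-rep covering minimal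

oddExtraPred : ℕ → ℕ → Bool
oddExtraPred k j = evens (k ∸ 1) j ∨ (j ≡ᵇ 2 * k)

oddReps : (k n : ℕ) → List (Labeling (suc n))
oddReps k n = ℓl n ∷ ℓr n ∷ ℓc n ∷ (chain n k ++ (mkLab n (oddExtraPred k) ∷ []))

module OddCase (t k : ℕ) (2k≡4+t : 2 * k ≡ 4 + t) (2[k∸1]≡2+t : 2 * (k ∸ 1) ≡ 2 + t) where

  open Representatives t

  1≤k : 1 ≤ k
  1≤k = *-cancelˡ-≤ 2 (subst (2 ≤_) (sym 2k≡4+t) (s≤s (s≤s z≤n)))

  2i<n : ∀ {i} → i < k → 2 * i < n
  2i<n {i} i<k = ≤-trans (*-monoʳ-< 2 i<k) (subst (_≤ n) (sym 2k≡4+t) (n≤1+n _))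

  extraRep : Lab t
  extraRep = mkLab n (oddExtraPred k)

  extraPred≡ : ∀ x → oddExtraPred k x ≡ evens (k ∸ 1) x ∨ (x ≡ᵇ 4 + t)
  extraPred≡ x = cong (λ z → evens (k ∸ 1) x ∨ (x ≡ᵇ z)) 2k≡4+t

  evens-beyond : ∀ x → 2 + t < x → evens (k ∸ 1) x ≡ false
  evens-beyond x 2+t<x = trans (cong (λ z → (2 ≤ᵇ x) ∧ (x ≤ᵇ z) ∧ isEven x) 2[k∸1]≡2+t)
    (trans (cong (λ z → (2 ≤ᵇ x) ∧ z) (cong (_∧ isEven x) (≤ᵇ-false 2+t<x))) (∧-zeroʳ _))

  Profile-extraRep : Profile t extraRep (holed (4 + t) 0) false false
  Profile-extraRep = Profile-cong
    (λ c c<n → trans (code-cong t _ _ (λ x _ → extraPred≡ x) c c<n) (code-oddExtra t (k ∸ 1) 2[k∸1]≡2+t c c<n))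
    (extraPred≡ 0) (trans (extraPred≡ n) (cong₂ _∨_ (evens-beyond n (m≤n+m (3 + t) 2)) (≡ᵇ-false n (4 + t) (≢-sym (n≢1+n _)))))
    (Profile-mkLab t (oddExtraPred k))

  weight-extraRep : weight extraRep ≡ k
  weight-extraRep = begin
    weight extraRep
      ≡⟨ weight-mkLab n (oddExtraPred k) ⟩
    sumTo (suc n) (λ x → bit (oddExtraPred k x))
      ≡⟨ sumTo-cong (suc n) (λ x _ → trans (cong bit (extraPred≡ x)) (bit-∨ (evens (k ∸ 1) x) (x ≡ᵇ 4 + t) (apart x))) ⟩
    sumTo (suc n) (λ x → bit (evens (k ∸ 1) x) + bit (x ≡ᵇ 4 + t))
      ≡⟨ sumTo-+ (suc n) (λ x → bit (evens (k ∸ 1) x)) (λ x → bit (x ≡ᵇ 4 + t)) ⟩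
    sumTo (suc n) (λ x → bit (evens (k ∸ 1) x)) + sumTo (suc n) (λ x → bit (x ≡ᵇ 4 + t))
      ≡⟨ cong₂ _+_ (weight-evens (k ∸ 1) (suc n) (subst (_< suc n) (sym 2[k∸1]≡2+t) (m≤n+m (3 + t) 3)))
                   (trans (sumTo-cong (suc n) (λ x _ → cong bit (sym (BP.∧-identityʳ (x ≡ᵇ 4 + t)))))
                          (sumTo-indicator (suc n) (4 + t) true (m≤n+m (5 + t) 1))) ⟩
    (k ∸ 1) + 1
      ≡⟨ m∸n+n≡m 1≤k ⟩
    k ∎
    where
    open ≡-Reasoning
    apart : ∀ x → evens (k ∸ 1) x ∧ (x ≡ᵇ 4 + t) ≡ false
    apart x = trans (BP.∧-comm (evens (k ∸ 1) x) _) (only-at (evens (k ∸ 1)) (4 + t) (evens-beyond (4 + t) (m≤n+m (3 + t) 1)) x)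

  rep : ℕ → Lab t
  rep 0 = ℓl n
  rep 1 = ℓr n
  rep 2 = ℓc n
  rep (suc (suc (suc j))) = if j <ᵇ k then chainRep j else extraRep

  rep-chain : ∀ i → i < k → rep (3 + i) ≡ chainRep i
  rep-chain i i<k rewrite <ᵇ-true i<k = refl

  rep-extra : ∀ e → rep (3 + (k + e)) ≡ extraRep
  rep-extra e rewrite <ᵇ-false {k + e} {k} (m≤m+n k e) = refl

  rep-rigid : ∀ a b → rep (rigidIndex a b) ≡ rigidRep a b
  rep-rigid true  false = refl
  rep-rigid false true  = refl
  rep-rigid true  true  = refl
  rep-rigid false false = rep-chain 0 1≤k

  enumerates : Enumerates (oddReps k n) rep
  enumerates = enumerates-∷ rep refl (enumerates-∷ (λ j → rep (1 + j)) refl (enumerates-∷ (λ j → rep (2 + j)) refl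
    (enumerates-map-upTo-++ chainRep k _ (λ j → rep (3 + j)) (λ i i<k → sym (rep-chain i i<k))
      (enumerates-∷ (λ e → rep (3 + (k + e))) (sym (rep-extra 0)) (enumerates-[] (λ e → rep (3 + (k + suc e))))))))

  length-oddReps : length (oddReps k n) ≡ k + 4
  length-oddReps = begin
    3 + length (chain n k ++ _)  ≡⟨ cong (3 +_) (length-++ (chain n k)) ⟩
    3 + (length (chain n k) + 1) ≡⟨ cong (λ l → 3 + (l + 1)) (trans (length-map _ (upTo k)) (length-upTo k)) ⟩
    3 + (k + 1)                  ≡⟨ cong (3 +_) (+-comm k 1) ⟩
    4 + k                        ≡⟨ +-comm 4 k ⟩
    k + 4                        ∎
    where open ≡-Reasoning

  classIndex-extraRep : classIndex t k extraRep ≡ 3 + k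
  classIndex-extraRep = trans (classIndex-Profile Profile-extraRep)
    (trans (cong (λ w → classIndex′ k n w false false) (trans (count-holed n (4 + t) ≤-refl) (sym 2k≡4+t)))
      (trans (classIndex′-middle k n (2 * k) false false (λ 2k≡0 → 0≢1+n (trans (sym 2k≡0) 2k≡4+t)) (λ 2k≡n → n≢1+n _ (trans (sym 2k≡4+t) 2k≡n)))
        (cong (3 +_) (⌊2*n/2⌋≡n k))))

  minimal-extraRep : ∀ d → Equiv (Tree t) d extraRep → weight extraRep ≤ weight d
  minimal-extraRep d eq = weight-minimal t k eq (trans (count-cong n (Profile.code≡ Profile-extraRep)) (trans (count-holed n (4 + t) ≤-refl) (sym 2k≡4+t)))
    weight-extraRep

  in-range : ∀ {j} → j < k + 4 → j < length (oddReps k n)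
  in-range {j} = subst (j <_) (sym length-oddReps)

  past-chain : ∀ j → ¬ j < k → 3 + j < length (oddReps k n) → 3 + (k + 0) ≡ 3 + j
  past-chain j j≮k 3+j<len = cong (3 +_) (trans (+-identityʳ k)
    (≤-antisym (≮⇒≥ j≮k) (≤-pred (≤-pred (≤-pred (≤-pred (subst (4 + j ≤_) (trans length-oddReps (+-comm k 4)) 3+j<len)))))))

  index-rep : ∀ j → j < length (oddReps k n) → classIndex t k (rep j) ≡ j
  index-rep 0 _ = classIndex-rigidRep k true false
  index-rep 1 _ = classIndex-rigidRep k false true
  index-rep 2 _ = classIndex-rigidRep k true true
  index-rep (suc (suc (suc j))) 3+j<len with j <? k
  ... | yes j<k = trans (cong (classIndex t k) (rep-chain j j<k)) (classIndex-chainRep k j (2i<n j<k))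
  ... | no j≮k = subst (λ i → classIndex t k (rep i) ≡ i) (past-chain j j≮k 3+j<len)
                   (trans (cong (classIndex t k) (rep-extra 0)) (trans classIndex-extraRep (cong (3 +_) (sym (+-identityʳ k)))))

  covering : ∀ d → Σ ℕ λ j → j < length (oddReps k n) × Equiv (Tree t) d (rep j)
  covering d with codeWeight-even t d
  ... | zero , w≡0 = rigidIndex a b , in-range (≤-trans (rigidIndex<4 a b) (m≤n+m 4 k)) ,
                     subst (Equiv (Tree t) d) (sym (rep-rigid a b)) (reach-rigidRep d w≡0)
    where a = lookupℕ d 0 ; b = lookupℕ d n
  ... | suc h , w≡2h with suc h <? k
  ...   | yes h<k = 3 + suc h , in-range (≤-trans (+-monoʳ-< 3 h<k) (≤-trans (≤-reflexive (+-comm 3 k)) (+-monoʳ-≤ k (n≤1+n 3)))) ,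
                    subst (Equiv (Tree t) d) (sym (rep-chain (suc h) h<k))
                      (reach-middle t (suc h) w≡2h (s≤s z≤n) (2i<n h<k) (Profile-chainRep (suc h) (2i<n h<k)))
  ...   | no h≮k = 3 + (k + 0) , in-range (subst (_< k + 4) (cong (3 +_) (sym (+-identityʳ k))) (≤-reflexive (+-comm 4 k))) ,
                   subst (Equiv (Tree t) d) (sym (rep-extra 0))
                     (reach-middle t (suc h) w≡2h (s≤s z≤n) 2h<n (subst (λ z → Profile t extraRep (holed z 0) false false) 4+t≡2h Profile-extraRep))
    where
    2h<n : 2 * suc h < n
    2h<n = subst (_< n) w≡2h (≤∧≢⇒< (count≤ n (codeOf t d)) (λ w≡n → odd-n (trans (sym w≡2h) w≡n)))
      where
      odd-n : 2 * suc h ≢ n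
      odd-n 2h≡n with trans (sym (isEven-2* (suc h))) (trans (cong isEven 2h≡n) (trans (isEven-suc (4 + t))
                        (cong not (trans (cong isEven (sym 2k≡4+t)) (isEven-2* k)))))
      ... | ()
    4+t≡2h : 4 + t ≡ 2 * suc h
    4+t≡2h = trans (sym 2k≡4+t) (cong (2 *_) (≤-antisym (≮⇒≥ h≮k) (*-cancelˡ-≤ 2 (subst (2 * suc h ≤_) (sym 2k≡4+t) (≤-pred 2h<n)))))

  minimal : ∀ j → j < length (oddReps k n) → ∀ d → Equiv (Tree t) d (rep j) → weight (rep j) ≤ weight d
  minimal 0 _ = minimal-rigidRep true false
  minimal 1 _ = minimal-rigidRep false true
  minimal 2 _ = minimal-rigidRep true true
  minimal (suc (suc (suc j))) 3+j<len with j <? k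
  ... | yes j<k rewrite rep-chain j j<k = minimal-chainRep j (2i<n j<k)
  ... | no j≮k = subst (λ i → ∀ d → Equiv (Tree t) d (rep i) → weight (rep i) ≤ weight d) (past-chain j j≮k 3+j<len)
                   (subst (λ r → ∀ d → Equiv (Tree t) d r → weight r ≤ weight d) (sym (rep-extra 0)) minimal-extraRep)

  oddReps-minimal : MinimalRepSystem (Tree t) (oddReps k n)
  oddReps-minimal = minimalRepSystem-byIndex (Tree t) (oddReps k n) rep (classIndex t k) enumerates (classIndex-invariant t k)
    index-rep covering minimal

classification-even : ∀ t k → 2 * k ≡ N t → 1 ≤ t → isOdd (2 + t) ≡ true →
  ClassCount (Dtilde (N t)) (k + 7) × MinimalRepSystem (Dtilde (N t)) (evenReps k (N t))
classification-even t k 2k≡n 1≤t odd =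
  MinimalRepSystem⇒ClassCount (Tree t) _ (k + 7) length-evenReps evenReps-minimal , evenReps-minimal
  where open EvenCase t k 2k≡n 1≤t odd

classification-odd : ∀ t k → 2 * k ≡ 4 + t → 2 * (k ∸ 1) ≡ 2 + t →
  ClassCount (Dtilde (N t)) (k + 4) × MinimalRepSystem (Dtilde (N t)) (oddReps k (N t))
classification-odd t k 2k≡4+t 2[k∸1]≡2+t =
  MinimalRepSystem⇒ClassCount (Tree t) _ (k + 4) length-oddReps oddReps-minimal , oddReps-minimal
  where open OddCase t k 2k≡4+t 2[k∸1]≡2+t

corollary-even : ∀ k → 5 ≤ 2 * k →
  ClassCount (Dtilde (2 * k)) (k + 7) × MinimalRepSystem (Dtilde (2 * k)) (repsEven k)
corollary-even zero ()
corollary-even (suc zero) (s≤s (s≤s ()))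
corollary-even (suc (suc zero)) (s≤s (s≤s (s≤s (s≤s ()))))
corollary-even (suc (suc (suc s))) _ =
  subst (λ m → ClassCount (Dtilde m) (k + 7) × MinimalRepSystem (Dtilde m) (evenReps k m)) (sym 2k≡n)
    (classification-even t k 2k≡n (s≤s z≤n) (cong not 3+2s-even))
  where
  k = 3 + s
  t = 1 + 2 * s
  2k≡n : 2 * k ≡ N t
  2k≡n = *-distribˡ-+ 2 3 s
  3+2s-even : isEven (3 + 2 * s) ≡ false
  3+2s-even = trans (isEven-2+ (1 + 2 * s)) (trans (isEven-suc (2 * s)) (cong not (isEven-2* s)))

corollary-odd : ∀ k → 5 ≤ 2 * k + 1 →
  ClassCount (Dtilde (2 * k + 1)) (k + 4) × MinimalRepSystem (Dtilde (2 * k + 1)) (repsOdd k)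
corollary-odd zero (s≤s ())
corollary-odd (suc zero) (s≤s (s≤s (s≤s ())))
corollary-odd (suc (suc s)) _ =
  subst (λ m → ClassCount (Dtilde m) (k + 4) × MinimalRepSystem (Dtilde m) (oddReps k m)) (sym 2k+1≡n)
    (classification-odd (2 * s) k 2k≡4+t (*-distribˡ-+ 2 1 s))
  where
  k = 2 + s
  2k≡4+t : 2 * k ≡ 4 + 2 * s
  2k≡4+t = *-distribˡ-+ 2 2 s
  2k+1≡n : 2 * k + 1 ≡ N (2 * s)
  2k+1≡n = trans (+-comm (2 * k) 1) (cong suc 2k≡4+t)

corollary2p46 :
    (∀ (k : ℕ) → 5 ≤ 2 * k →
      ClassCount (Dtilde (2 * k)) (k + 7) × MinimalRepSystem (Dtilde (2 * k)) (repsEven k))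
    × (∀ (k : ℕ) → 5 ≤ 2 * k + 1 →
      ClassCount (Dtilde (2 * k + 1)) (k + 4) × MinimalRepSystem (Dtilde (2 * k + 1)) (repsOdd k))
corollary2p46 = corollary-even , corollary-odd
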